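{- As classes of (families of) Boolean functions, \[ \overline{\mathrm{NN}} = \mathrm{mpPTF}(\infty), \qquad \overline{\mathrm{HNN}} = \mathrm{mpPTF}(\mathrm{poly}(n)). \]
   Context: All classes below are classes of families $(f_n)_{n\ge 1}$ of Boolean functions $f_n:\{0,1\}^n\to\{0,1\}$, and "polynomial" means polynomial in $n$. Let $\Delta(\mathbf{x},\mathbf{y})=\|\mathbf{x}-\mathbf{y}\|_2^2$. A nearest neighbor (NN) representation of $f:\{0,1\}^n\to\{0,1\}$ is a pair of disjoint finite sets $P,N\subseteq\mathbb{R}^n$ (anchors) such that $f(\mathbf{x})=1$ if there is $\mathbf{p}\in P$ with $\Delta(\mathbf{x},\mathbf{p})<\Delta(\mathbf{x},\mathbf{q})$ for all $\mathbf{q}\in N$, and $f(\mathbf{x})=0$ if there is $\mathbf{q}\in N$ with $\Delta(\mathbf{x},\mathbf{q})<\Delta(\mathbf{x},\mathbf{p})$ for all $\mathbf{p}\in P$; the number of anchors is $|P|+|N|$. A Hamming nearest neighbor (HNN) representation is the same with $P,N\subseteq\{0,1\}^n$. $\mathrm{NN}$ (resp. $\mathrm{HNN}$) is the class of functions having NN (resp. HNN) representations with polynomially many anchors. A substitution of variables $v:\{0,1\}^n\to\{0,1\}^{\tilde n}$ maps $\mathbf{x}$ to a vector each of whose coordinates is either some $x_i$ (variables may be duplicated) or a constant $0$ or $1$. $f:\{0,1\}^n\to\{0,1\}$ is a subfunction of $g:\{0,1\}^{\tilde n}\to\{0,1\}$ if $\tilde n=\mathrm{poly}(n)$ and there is a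 substitution $v$ with $f(\mathbf{x})=g(v(\mathbf{x}))$ for all $\mathbf{x}$. For a class $C$, its closure $\overline{C}$ is the set of subfunctions of members of $C$. A min-plus polynomial threshold function (mpPTF) is given by linear forms with integer coefficients $L_1,\dots,L_{\ell_1},R_1,\dots,R_{\ell_2}$ (affine functions of $\mathbf{x}$) via $f(\mathbf{x})=1\iff\min_i L_i(\mathbf{x})\le\min_j R_j(\mathbf{x})$; it has $\ell_1+\ell_2$ terms and its maximum weight is the largest absolute value of a coefficient of any form. $\mathrm{mpPTF}(\infty)$ is the class of functions computed by mpPTFs with polynomially many terms and unbounded weights; $\mathrm{mpPTF}(\mathrm{poly}(n))$ additionally requires polynomially bounded maximum weight.
   Formalization: The anchors $P,N$ of NN representations are taken in ℚ^n instead of ℝ^n. -}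

module Defs where

open import Data.Bool using (Bool; true; false; if_then_else_)
open import Data.Nat as ℕ using (ℕ; _^_)
open import Data.Integer as ℤ using (ℤ; _⊓_; ∣_∣)
open import Data.Rational as ℚ using (ℚ)
open import Data.Fin using (Fin)
open import Data.Vec as Vec using (Vec; zipWith; lookup)
open import Data.Vec.Relation.Unary.All as VAll using ()
open import Data.List as List using (List; length; foldr)
open import Data.List.Relation.Unary.All as LAll using ()
open import Data.List.Membership.Propositional using (_∈_)
open import Data.Product using (Σ; ∃; ∃-syntax; _×_; _,_)
open import Data.Empty using (⊥)
open import Relation.Binary.PropositionalEquality using (_≡_)

BF : ℕ → Set
BF n = Vec Bool n → Bool

Family : Set
Family = (n : ℕ) → BF n

Class : Set₁
Class = Family → Set

_≐_ : Class → Class → Set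
C ≐ D = ∀ f → (C f → D f) × (D f → C f)

-- "polynomial in n": every polynomial is bounded by c * n ^ c + c for some c
poly : ℕ → ℕ → ℕ
poly c n = c ℕ.* n ^ c ℕ.+ c

b2q : Bool → ℚ
b2q b = if b then ℚ.1ℚ else ℚ.0ℚ

Δ : ∀ {n} → Vec ℚ n → Vec ℚ n → ℚ
Δ x y = Vec.foldr _ ℚ._+_ ℚ.0ℚ (zipWith (λ a b → (a ℚ.- b) ℚ.* (a ℚ.- b)) x y)

embed : ∀ {n} → Vec Bool n → Vec ℚ n
embed = Vec.map b2q

record NNRep {n : ℕ} (f : BF n) (P N : List (Vec ℚ n)) : Set where
  field
    disjoint : ∀ p → p ∈ P → p ∈ N → ⊥
    pos : ∀ x → f x ≡ true →
          ∃[ p ] (p ∈ P × (∀ q → q ∈ N → Δ (embed x) p ℚ.< Δ (embed x) q))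
    neg : ∀ x → f x ≡ false →
          ∃[ q ] (q ∈ N × (∀ p → p ∈ P → Δ (embed x) q ℚ.< Δ (embed x) p))

NN : Class
NN f = ∃[ c ] ∀ n → ∃[ P ] ∃[ N ]
  (NNRep (f n) P N × length P ℕ.+ length N ℕ.≤ poly c n)

HNN : Class
HNN f = ∃[ c ] ∀ n → ∃[ P ] ∃[ N ]
  (NNRep (f n) (List.map embed P) (List.map embed N)
    × length P ℕ.+ length N ℕ.≤ poly c n)

data Lit (n : ℕ) : Set where
  var   : Fin n → Lit n
  const : Bool → Lit n

evalLit : ∀ {n} → Lit n → Vec Bool n → Bool
evalLit (var i)   x = lookup x i
evalLit (const b) x = b

Subst : ℕ → ℕ → Set
Subst n m = Vec (Lit n) m

applySubst : ∀ {n m} → Subst n m → Vec Bool n → Vec Bool m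
applySubst σ x = Vec.map (λ l → evalLit l x) σ

SubfunctionVia : ∀ {n m} → BF n → BF m → Set
SubfunctionVia {n} {m} f g = ∃[ σ ] (∀ x → f x ≡ g (applySubst {n} {m} σ x))

closure : Class → Class
closure C f = ∃[ g ] (C g × ∃[ c ] ∀ n → ∃[ m ]
  (m ℕ.≤ poly c n × SubfunctionVia (f n) (g m)))

LinForm : ℕ → Set
LinForm n = ℤ × Vec ℤ n

b2z : Bool → ℤ
b2z b = if b then ℤ.1ℤ else ℤ.0ℤ

evalForm : ∀ {n} → LinForm n → Vec Bool n → ℤ
evalForm (a₀ , as) x = a₀ ℤ.+ Vec.foldr _ ℤ._+_ ℤ.0ℤ (zipWith (λ a b → a ℤ.* b2z b) as x)

-- minimum of a nonempty list of forms (given as head and tail)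
minForms : ∀ {n} → LinForm n → List (LinForm n) → Vec Bool n → ℤ
minForms L Ls x = foldr (λ K m → evalForm K x ⊓ m) (evalForm L x) Ls

record MpPTFRep {n : ℕ} (f : BF n) (L : LinForm n) (Ls : List (LinForm n))
                (R : LinForm n) (Rs : List (LinForm n)) : Set where
  field
    sound    : ∀ x → f x ≡ true → minForms L Ls x ℤ.≤ minForms R Rs x
    complete : ∀ x → minForms L Ls x ℤ.≤ minForms R Rs x → f x ≡ true

terms : ∀ {n} → List (LinForm n) → List (LinForm n) → ℕ
terms Ls Rs = ℕ.suc (length Ls) ℕ.+ ℕ.suc (length Rs)

WeightBound : ∀ {n} → ℕ → LinForm n → Set
WeightBound W (a₀ , as) = ∣ a₀ ∣ ℕ.≤ W × VAll.All (λ a → ∣ a ∣ ℕ.≤ W) as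

AllWeight : ∀ {n} → ℕ → LinForm n → List (LinForm n) → Set
AllWeight W L Ls = WeightBound W L × LAll.All (WeightBound W) Ls

mpPTF∞ : Class
mpPTF∞ f = ∃[ c ] ∀ n → ∃[ L ] ∃[ Ls ] ∃[ R ] ∃[ Rs ]
  (MpPTFRep (f n) L Ls R Rs × terms Ls Rs ℕ.≤ poly c n)

mpPTFpoly : Class
mpPTFpoly f = ∃[ c ] ∀ n → ∃[ L ] ∃[ Ls ] ∃[ R ] ∃[ Rs ]
  (MpPTFRep (f n) L Ls R Rs × terms Ls Rs ℕ.≤ poly c n
    × AllWeight (poly c n) L Ls × AllWeight (poly c n) R Rs)

-- Clearing denominators turns rational anchors a/D into integer ones, with squared distance
-- Δℤ D y a = Σᵢ (D yᵢ − aᵢ)² = D²·Δ(y, a/D). For Boolean y this is an affine function of y, hence of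
-- the variables of any substitution, so asking whether the nearest anchor is positive is the min-plus
-- threshold condition min (1 + Δℤ to positive anchors) ≤ min (Δℤ to negative anchors); Boolean anchors
-- give weights bounded by the dimension.
--
-- Conversely, for an mpPTF with forms Lᵢ, Rⱼ we build, for every form F and ε ∈ {0, 1}, an anchor whose
-- distance from the substituted input x is K + S·(2F(x) + ε) + junk with 0 ≤ junk < S (ε = 0 for the
-- Lᵢ, 1 for the Rⱼ); then the nearest anchor is positive exactly when min Lᵢ ≤ min Rⱼ. Every input
-- coordinate gets a gadget: with rational anchors a pair of coordinates whose squares are linear in
-- the coefficient up to a junk term made negligible by a large scale S, with Boolean anchors two
-- blocks writing the (bounded) coefficient in unary, which makes the formula exact. Ties are
-- excluded at every Boolean point, not only at substituted inputs, because the parity of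
-- Δℤ y p − Δℤ y q does not depend on y and is odd at one reference input whenever p is positive and
-- q negative. The size of these constructions is an injective function of n, and the family is
-- taken constant off its image.

module Submission where

open import Defs
open import Data.Bool using (Bool; true; false)
open import Data.Nat as ℕ using (ℕ; zero; suc)
import Data.Nat.Properties as ℕ
open import Data.Fin using (Fin; zero; suc)
open import Data.Integer using (ℤ; +_)
open import Data.Vec as Vec using (Vec; []; _∷_; _++_)
open import Data.List as List using (List; []; _∷_; length)
open import Data.List.Properties using (length-map; map-cong; map-∘)
open import Data.List.Membership.Propositional using (_∈_)
open import Data.List.Membership.Propositional.Properties using (∈-map⁺; ∈-map⁻)
open import Data.List.Relation.Unary.Any using (here; there)
open import Data.Product using (Σ; Σ-syntax; ∃-syntax; _×_; _,_; proj₁; proj₂)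
open import Function using (_∘_)
open import Relation.Binary.PropositionalEquality

module Minima where

  open import Data.Integer using (_⊓_; _≤_; _<_)
  open import Data.Integer.Properties
  open import Data.Sum using (inj₁; inj₂)
  open import Relation.Nullary using (yes; no; contradiction)

  minBy : {X : Set} → (X → ℤ) → X → List X → ℤ
  minBy h x xs = List.foldr (λ u r → h u ⊓ r) (h x) xs

  module _ {X : Set} (h : X → ℤ) where

    minBy-≤ : ∀ {x u} xs → u ∈ x ∷ xs → minBy h x xs ≤ h u
    minBy-≤ []       (here refl)         = ≤-refl
    minBy-≤ (w ∷ xs) (here refl)         = i≤j⇒k⊓i≤j (h w) (minBy-≤ xs (here refl))
    minBy-≤ (w ∷ xs) (there (here refl)) = i⊓j≤i (h w) _
    minBy-≤ (w ∷ xs) (there (there u∈))  = i≤j⇒k⊓i≤j (h w) (minBy-≤ xs (there u∈))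

    minBy-attained : ∀ x xs → ∃[ u ] (u ∈ x ∷ xs × minBy h x xs ≡ h u)
    minBy-attained x []       = x , here refl , refl
    minBy-attained x (w ∷ xs) with ⊓-sel (h w) (minBy h x xs) | minBy-attained x xs
    ... | inj₁ min≡w | _                   = w , there (here refl) , min≡w
    ... | inj₂ min≡r | u , here refl , r≡u = u , here refl , trans min≡r r≡u
    ... | inj₂ min≡r | u , there u∈ , r≡u  = u , there (there u∈) , trans min≡r r≡u

  module _ {X Y : Set} (e₁ h₁ : X → ℤ) (e₂ h₂ : Y → ℤ) {x : X} {xs : List X} {y : Y} {ys : List Y}
    (separate-≤ : ∀ {u v} → u ∈ x ∷ xs → v ∈ y ∷ ys → e₁ u ≤ e₂ v → h₁ u < h₂ v)
    (separate-> : ∀ {u v} → u ∈ x ∷ xs → v ∈ y ∷ ys → e₂ v < e₁ u → h₂ v < h₁ u) where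

    minBy-≤⇒minBy-< : minBy e₁ x xs ≤ minBy e₂ y ys → minBy h₁ x xs < minBy h₂ y ys
    minBy-≤⇒minBy-< e₁≤e₂
      with minBy-attained e₁ x xs | minBy-attained h₂ y ys
    ... | u , u∈ , min≡e₁u | v , v∈ , min≡h₂v = begin-strict
      minBy h₁ x xs  ≤⟨ minBy-≤ h₁ xs u∈ ⟩
      h₁ u           <⟨ separate-≤ u∈ v∈ e₁u≤e₂v ⟩
      h₂ v           ≡⟨ min≡h₂v ⟨
      minBy h₂ y ys  ∎
      where
      open ≤-Reasoning
      e₁u≤e₂v : e₁ u ≤ e₂ v
      e₁u≤e₂v = begin
        e₁ u           ≡⟨ min≡e₁u ⟨
        minBy e₁ x xs  ≤⟨ e₁≤e₂ ⟩
        minBy e₂ y ys  ≤⟨ minBy-≤ e₂ ys v∈ ⟩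
        e₂ v           ∎

    minBy-<⇒minBy-≤ : minBy h₁ x xs < minBy h₂ y ys → minBy e₁ x xs ≤ minBy e₂ y ys
    minBy-<⇒minBy-≤ h₁<h₂ with minBy e₁ x xs ≤? minBy e₂ y ys
    ... | yes e₁≤e₂ = e₁≤e₂
    ... | no e₁≰e₂ with minBy-attained e₂ y ys | minBy-attained h₁ x xs
    ...   | v , v∈ , min≡e₂v | u , u∈ , min≡h₁u = contradiction h₁<h₂ (≤⇒≯ h₂≤h₁)
      where
      open ≤-Reasoning
      e₂v<e₁u : e₂ v < e₁ u
      e₂v<e₁u = begin-strict
        e₂ v           ≡⟨ min≡e₂v ⟨
        minBy e₂ y ys  <⟨ ≰⇒> e₁≰e₂ ⟩
        minBy e₁ x xs  ≤⟨ minBy-≤ e₁ xs u∈ ⟩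
        e₁ u           ∎
      h₂≤h₁ : minBy h₂ y ys ≤ minBy h₁ x xs
      h₂≤h₁ = begin
        minBy h₂ y ys  ≤⟨ minBy-≤ h₂ ys v∈ ⟩
        h₂ v           ≤⟨ <⇒≤ (separate-> u∈ v∈ e₂v<e₁u) ⟩
        h₁ u           ≡⟨ min≡h₁u ⟨
        minBy h₁ x xs  ∎

module IntegerDistance where

  open import Data.Integer using (-[1+_]; 0ℤ; 1ℤ; _+_; _*_; _-_; _≤_; +≤+; ∣_∣)
  open import Data.Integer.Properties using (+-identityˡ; +-assoc; ≤-trans; ≤-reflexive; pos-*)
  open import Data.Integer.Tactic.RingSolver using (solve-∀)

  sq : ℤ → ℤ
  sq z = z * z

  sq-nonneg : ∀ z → 0ℤ ≤ sq z
  sq-nonneg (+ k)    = ≤-trans (+≤+ ℕ.z≤n) (≤-reflexive (pos-* k k))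
  sq-nonneg -[1+ k ] = +≤+ ℕ.z≤n

  Δℤ : ∀ {m} → ℤ → Vec Bool m → Vec ℤ m → ℤ
  Δℤ D y a = Vec.foldr _ _+_ 0ℤ (Vec.zipWith (λ b z → sq (D * b2z b - z)) y a)

  Δℤ-++ : ∀ {k l} D (y : Vec Bool k) (a : Vec ℤ k) (y′ : Vec Bool l) (a′ : Vec ℤ l) →
          Δℤ D (y ++ y′) (a ++ a′) ≡ Δℤ D y a + Δℤ D y′ a′
  Δℤ-++ D []      []      y′ a′ = sym (+-identityˡ _)
  Δℤ-++ D (b ∷ y) (z ∷ a) y′ a′ =
    trans (cong (_+_ (sq (D * b2z b - z))) (Δℤ-++ D y a y′ a′))
          (sym (+-assoc (sq (D * b2z b - z)) (Δℤ D y a) (Δℤ D y′ a′)))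

  two*≢odd : ∀ i j → + 2 * i ≢ + 2 * j + 1ℤ
  two*≢odd i j eq = two*≢1 (i - j) (begin
    + 2 * (i - j)             ≡⟨ distrib i j ⟩
    + 2 * i - + 2 * j         ≡⟨ cong (_- + 2 * j) eq ⟩
    + 2 * j + 1ℤ - + 2 * j    ≡⟨ cancel j ⟩
    1ℤ                        ∎)
    where
    open ≡-Reasoning
    distrib : ∀ i j → + 2 * (i - j) ≡ + 2 * i - + 2 * j
    distrib = solve-∀
    cancel : ∀ j → + 2 * j + 1ℤ - + 2 * j ≡ 1ℤ
    cancel = solve-∀
    two*≢1 : ∀ k → + 2 * k ≢ 1ℤ
    two*≢1 (+ suc k) eq = ℕ.m+1+n≢0 k (ℕ.suc-injective (cong ∣_∣ eq))
    two*≢1 (+ zero)  ()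
    two*≢1 -[1+ k ]  ()

  Δℤ-parity-shift : ∀ {m} D (y z : Vec Bool m) (a b : Vec ℤ m) →
                    ∃[ k ] (Δℤ D y a + Δℤ D z b ≡ Δℤ D y b + Δℤ D z a + + 2 * k)
  Δℤ-parity-shift D []      []      []      []      = 0ℤ , refl
  Δℤ-parity-shift D (s ∷ y) (t ∷ z) (a ∷ as) (b ∷ bs) with Δℤ-parity-shift D y z as bs
  ... | k , shift = (u - v) * (b - a) + k , (begin
      (sq (u - a) + Δℤ D y as) + (sq (v - b) + Δℤ D z bs)
    ≡⟨ regroup (sq (u - a)) (Δℤ D y as) (sq (v - b)) (Δℤ D z bs) ⟩
      sq (u - a) + sq (v - b) + (Δℤ D y as + Δℤ D z bs)
    ≡⟨ cong (_+_ (sq (u - a) + sq (v - b))) shift ⟩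
      sq (u - a) + sq (v - b) + (Δℤ D y bs + Δℤ D z as + + 2 * k)
    ≡⟨ swap u v a b (Δℤ D y bs) (Δℤ D z as) k ⟩
      (sq (u - b) + Δℤ D y bs) + (sq (v - a) + Δℤ D z as) + + 2 * ((u - v) * (b - a) + k) ∎)
    where
    open ≡-Reasoning
    u = D * b2z s
    v = D * b2z t
    regroup : ∀ p A q B → (p + A) + (q + B) ≡ p + q + (A + B)
    regroup = solve-∀
    swap : ∀ u v a b P Q k →
           (u - a) * (u - a) + (v - b) * (v - b) + (P + Q + + 2 * k)
           ≡ ((u - b) * (u - b) + P) + ((v - a) * (v - a) + Q) + + 2 * ((u - v) * (b - a) + k)
    swap = solve-∀

  Δℤ-no-tie : ∀ {m} D (y z : Vec Bool m) (a b : Vec ℤ m) →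
              ∃[ j ] (Δℤ D z b ≡ Δℤ D z a + (+ 2 * j + 1ℤ)) → Δℤ D y a ≢ Δℤ D y b
  Δℤ-no-tie D y z a b (j , odd) tie with Δℤ-parity-shift D y z a b
  ... | k , shift = two*≢odd k j (begin
    + 2 * k                                               ≡⟨ isolate (Δℤ D y b) (Δℤ D z a) k ⟩
    Δℤ D y b + Δℤ D z a + + 2 * k - (Δℤ D y b + Δℤ D z a) ≡⟨ cong (_- (Δℤ D y b + Δℤ D z a)) (sym shift) ⟩
    Δℤ D y a + Δℤ D z b - (Δℤ D y b + Δℤ D z a)
      ≡⟨ cong₂ (λ p q → p + q - (Δℤ D y b + Δℤ D z a)) tie odd ⟩
    Δℤ D y b + (Δℤ D z a + (+ 2 * j + 1ℤ)) - (Δℤ D y b + Δℤ D z a)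
      ≡⟨ cancel (Δℤ D y b) (Δℤ D z a) (+ 2 * j + 1ℤ) ⟩
    + 2 * j + 1ℤ                                          ∎)
    where
    open ≡-Reasoning
    isolate : ∀ P Q k → + 2 * k ≡ P + Q + + 2 * k - (P + Q)
    isolate = solve-∀
    cancel : ∀ P Q r → P + (Q + r) - (P + Q) ≡ r
    cancel = solve-∀

module RationalScaling where

  import Data.Integer as ℤ
  import Data.Integer.Properties as ℤ
  import Data.Vec.Properties as Vec
  open import Data.Integer.Tactic.RingSolver using (solve-∀)
  open import Data.Rational using (ℚ; mkℚ; toℚᵘ; 1/_; _+_; _*_; _-_; -_; _<_; *<*; 1ℚ; Positive)
  open import Data.Rational.Literals using (fromℤ)
  open import Data.Rational.Properties
  import Data.Rational.Unnormalised as ℚᵘ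
  import Data.Rational.Unnormalised.Properties as ℚᵘ
  open import Data.Maybe using (nothing)
  open import Level using (0ℓ)
  import Tactic.RingSolver as RingSolver
  import Tactic.RingSolver.Core.AlmostCommutativeRing as ACR
  open IntegerDistance

  1/suc : ℕ → ℚ
  1/suc d = 1/ fromℤ (+ suc d)

  toℚᵘ-scaled : ∀ z d → toℚᵘ (fromℤ z * 1/suc d) ℚᵘ.≃ ℚᵘ.mkℚᵘ z d
  toℚᵘ-scaled z d = ℚᵘ.≃-trans (toℚᵘ-homo-* (fromℤ z) (1/suc d)) (ℚᵘ.*≡* (rearrange z (+ suc d)))
    where
    rearrange : ∀ z D → (z ℤ.* + 1) ℤ.* D ≡ z ℤ.* (+ 1 ℤ.* D)
    rearrange = solve-∀

  scaled-≡ : ∀ z d z′ d′ → z ℤ.* + suc d′ ≡ z′ ℤ.* + suc d → fromℤ z * 1/suc d ≡ fromℤ z′ * 1/suc d′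
  scaled-≡ z d z′ d′ eq = toℚᵘ-injective
    (ℚᵘ.≃-trans (toℚᵘ-scaled z d) (ℚᵘ.≃-trans (ℚᵘ.*≡* eq) (ℚᵘ.≃-sym (toℚᵘ-scaled z′ d′))))

  fromℤ-+ : ∀ u v → fromℤ (u ℤ.+ v) ≡ fromℤ u + fromℤ v
  fromℤ-+ u v = toℚᵘ-injective
    (ℚᵘ.≃-trans (ℚᵘ.*≡* (rearrange u v)) (ℚᵘ.≃-sym (toℚᵘ-homo-+ (fromℤ u) (fromℤ v))))
    where
    rearrange : ∀ u v → (u ℤ.+ v) ℤ.* + 1 ≡ (u ℤ.* + 1 ℤ.+ v ℤ.* + 1) ℤ.* + 1
    rearrange = solve-∀

  fromℤ-* : ∀ u v → fromℤ (u ℤ.* v) ≡ fromℤ u * fromℤ v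
  fromℤ-* u v = toℚᵘ-injective (ℚᵘ.≃-sym (toℚᵘ-homo-* (fromℤ u) (fromℤ v)))

  fromℤ-neg : ∀ u → fromℤ (ℤ.- u) ≡ - fromℤ u
  fromℤ-neg u = toℚᵘ-injective (ℚᵘ.≃-sym (toℚᵘ-homo‿- (fromℤ u)))

  scaled-one : ∀ d → fromℤ (+ suc d) * 1/suc d ≡ 1ℚ
  scaled-one d = trans (scaled-≡ (+ suc d) d (+ 1) 0 (ℤ.*-comm (+ suc d) (+ 1))) refl

  b2q≡fromℤ∘b2z : ∀ b → b2q b ≡ fromℤ (b2z b)
  b2q≡fromℤ∘b2z true  = refl
  b2q≡fromℤ∘b2z false = refl

  fromℤ-mono-< : ∀ {u v} → u ℤ.< v → fromℤ u < fromℤ v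
  fromℤ-mono-< {u} {v} u<v = *<* (subst₂ ℤ._<_ (sym (ℤ.*-identityʳ u)) (sym (ℤ.*-identityʳ v)) u<v)

  fromℤ-cancel-< : ∀ {u v} → fromℤ u < fromℤ v → u ℤ.< v
  fromℤ-cancel-< {u} {v} (*<* u<v) = subst₂ ℤ._<_ (ℤ.*-identityʳ u) (ℤ.*-identityʳ v) u<v

  scaleDown : ∀ {m} → ℕ → Vec ℤ m → Vec ℚ m
  scaleDown d = Vec.map (λ z → fromℤ z * 1/suc d)

  private
    ringℚ : ACR.AlmostCommutativeRing 0ℓ 0ℓ
    ringℚ = ACR.fromCommutativeRing +-*-commutativeRing (λ _ → nothing)

  Δ-coordinate : ∀ d b z → let s = fromℤ z * 1/suc d in
    (b2q b - s) * (b2q b - s) ≡ (1/suc d * 1/suc d) * fromℤ (sq (+ suc d ℤ.* b2z b ℤ.- z))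
  Δ-coordinate d b z = begin
      (b2q b - Z * κ) * (b2q b - Z * κ)
    ≡⟨ cong (λ t → (t - Z * κ) * (t - Z * κ)) b2q≡DκX ⟩
      (D * κ * X - Z * κ) * (D * κ * X - Z * κ)
    ≡⟨ factor D κ X Z ⟩
      κ * κ * ((D * X + - Z) * (D * X + - Z))
    ≡⟨ cong (κ * κ *_) (sym (trans (fromℤ-* w w) (cong₂ _*_ fromℤ-w fromℤ-w))) ⟩
      κ * κ * fromℤ (sq w) ∎
    where
    open ≡-Reasoning
    κ = 1/suc d
    D = fromℤ (+ suc d)
    X = fromℤ (b2z b)
    Z = fromℤ z
    w = + suc d ℤ.* b2z b ℤ.- z
    b2q≡DκX : b2q b ≡ D * κ * X
    b2q≡DκX = begin
      b2q b        ≡⟨ b2q≡fromℤ∘b2z b ⟩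
      X            ≡⟨ *-identityˡ X ⟨
      1ℚ * X       ≡⟨ cong (_* X) (scaled-one d) ⟨
      D * κ * X    ∎
    fromℤ-w : fromℤ w ≡ D * X + - Z
    fromℤ-w = trans (fromℤ-+ (+ suc d ℤ.* b2z b) (ℤ.- z)) (cong₂ _+_ (fromℤ-* (+ suc d) (b2z b)) (fromℤ-neg z))
    factor : ∀ D κ X Z → (D * κ * X - Z * κ) * (D * κ * X - Z * κ) ≡ κ * κ * ((D * X + - Z) * (D * X + - Z))
    factor = RingSolver.solve-∀ ringℚ

  Δ-scaleDown : ∀ {m} d (y : Vec Bool m) (a : Vec ℤ m) →
                Δ (embed y) (scaleDown d a) ≡ (1/suc d * 1/suc d) * fromℤ (Δℤ (+ suc d) y a)
  Δ-scaleDown d []      []      = sym (*-zeroʳ (1/suc d * 1/suc d))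
  Δ-scaleDown d (b ∷ y) (z ∷ a) = begin
      (b2q b - fromℤ z * 1/suc d) * (b2q b - fromℤ z * 1/suc d) + Δ (embed y) (scaleDown d a)
    ≡⟨ cong₂ _+_ (Δ-coordinate d b z) (Δ-scaleDown d y a) ⟩
      κκ * fromℤ (sq (+ suc d ℤ.* b2z b ℤ.- z)) + κκ * fromℤ (Δℤ (+ suc d) y a)
    ≡⟨ *-distribˡ-+ κκ (fromℤ (sq (+ suc d ℤ.* b2z b ℤ.- z))) (fromℤ (Δℤ (+ suc d) y a)) ⟨
      κκ * (fromℤ (sq (+ suc d ℤ.* b2z b ℤ.- z)) + fromℤ (Δℤ (+ suc d) y a))
    ≡⟨ cong (κκ *_) (fromℤ-+ (sq (+ suc d ℤ.* b2z b ℤ.- z)) (Δℤ (+ suc d) y a)) ⟨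
      κκ * fromℤ (Δℤ (+ suc d) (b ∷ y) (z ∷ a)) ∎
    where
    open ≡-Reasoning
    κκ = 1/suc d * 1/suc d

  1/suc²-positive : ∀ d → Positive (1/suc d * 1/suc d)
  1/suc²-positive d = pos*pos⇒pos (1/suc d) (1/suc d)

  Δ-scaleDown-mono-< : ∀ {m} d (y : Vec Bool m) (a b : Vec ℤ m) →
    Δℤ (+ suc d) y a ℤ.< Δℤ (+ suc d) y b → Δ (embed y) (scaleDown d a) < Δ (embed y) (scaleDown d b)
  Δ-scaleDown-mono-< d y a b lt = subst₂ _<_ (sym (Δ-scaleDown d y a)) (sym (Δ-scaleDown d y b))
    (*-monoʳ-<-pos (1/suc d * 1/suc d) {{1/suc²-positive d}} (fromℤ-mono-< lt))

  Δ-scaleDown-cancel-< : ∀ {m} d (y : Vec Bool m) (a b : Vec ℤ m) →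
    Δ (embed y) (scaleDown d a) < Δ (embed y) (scaleDown d b) → Δℤ (+ suc d) y a ℤ.< Δℤ (+ suc d) y b
  Δ-scaleDown-cancel-< d y a b lt = fromℤ-cancel-<
    (*-cancelˡ-<-nonNeg (1/suc d * 1/suc d) {{pos⇒nonNeg (1/suc d * 1/suc d) {{1/suc²-positive d}}}}
      (subst₂ _<_ (Δ-scaleDown d y a) (Δ-scaleDown d y b) lt))

  infixl 7 _⊛_
  -- suc (d ⊛ k) reduces to suc d ℕ.* suc k.
  _⊛_ : ℕ → ℕ → ℕ
  d ⊛ k = k ℕ.+ d ℕ.* suc k

  ⊛-comm : ∀ d k → d ⊛ k ≡ k ⊛ d
  ⊛-comm d k = cong ℕ.pred (ℕ.*-comm (suc d) (suc k))

  scaled-refine : ∀ z d k → fromℤ z * 1/suc d ≡ fromℤ (z ℤ.* + suc k) * 1/suc (d ⊛ k)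
  scaled-refine z d k = scaled-≡ z d (z ℤ.* + suc k) (d ⊛ k) (begin
    z ℤ.* + (suc d ℕ.* suc k)      ≡⟨ cong (z ℤ.*_) (ℤ.pos-* (suc d) (suc k)) ⟩
    z ℤ.* (+ suc d ℤ.* + suc k)    ≡⟨ rearrange z (+ suc d) (+ suc k) ⟩
    z ℤ.* + suc k ℤ.* + suc d      ∎)
    where
    open ≡-Reasoning
    rearrange : ∀ z D K → z ℤ.* (D ℤ.* K) ≡ z ℤ.* K ℤ.* D
    rearrange = solve-∀

  scaleDown-refine : ∀ {m} d k (a : Vec ℤ m) → scaleDown d a ≡ scaleDown (d ⊛ k) (Vec.map (ℤ._* + suc k) a)
  scaleDown-refine d k a = trans (Vec.map-cong (λ z → scaled-refine z d k) a) (Vec.map-∘ _ _ a)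

  scaleDown-refineˡ : ∀ {m} d k (a : Vec ℤ m) → scaleDown d a ≡ scaleDown (k ⊛ d) (Vec.map (ℤ._* + suc k) a)
  scaleDown-refineˡ d k a =
    trans (scaleDown-refine d k a) (cong (λ t → scaleDown t (Vec.map (ℤ._* + suc k) a)) (⊛-comm d k))

  map-scaleDown : ∀ {m d d′} {g : Vec ℤ m → Vec ℤ m} → (∀ a → scaleDown d a ≡ scaleDown d′ (g a)) →
                  ∀ QZ → List.map (scaleDown d) QZ ≡ List.map (scaleDown d′) (List.map g QZ)
  map-scaleDown {d′ = d′} {g} refine QZ = trans (map-cong refine QZ) (map-∘ {g = scaleDown d′} {f = g} QZ)

  rational≡scaled : ∀ q → q ≡ fromℤ (ℚ.numerator q) * 1/suc (ℚ.denominator-1 q)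
  rational≡scaled q@(mkℚ _ _ _) = toℚᵘ-injective (ℚᵘ.≃-sym (toℚᵘ-scaled (ℚ.numerator q) (ℚ.denominator-1 q)))

  vector-denominator : ∀ {m} (v : Vec ℚ m) → ∃[ d ] ∃[ a ] (v ≡ scaleDown d a)
  vector-denominator []      = 0 , [] , refl
  vector-denominator (q ∷ v) with vector-denominator v
  ... | d , a , v≡ = e ⊛ d , (ℚ.numerator q ℤ.* + suc d) ∷ Vec.map (ℤ._* + suc e) a ,
                     cong₂ _∷_ (trans (rational≡scaled q) (scaled-refine (ℚ.numerator q) e d))
                               (trans v≡ (scaleDown-refineˡ d e a))
    where
    e = ℚ.denominator-1 q

  list-denominator : ∀ {m} (Q : List (Vec ℚ m)) → ∃[ d ] ∃[ QZ ] (Q ≡ List.map (scaleDown d) QZ)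
  list-denominator []      = 0 , [] , refl
  list-denominator (v ∷ Q) with vector-denominator v | list-denominator Q
  ... | e , a , v≡ | d , QZ , Q≡ =
    e ⊛ d , Vec.map (ℤ._* + suc d) a ∷ List.map (Vec.map (ℤ._* + suc e)) QZ ,
    cong₂ _∷_ (trans v≡ (scaleDown-refine e d a)) (trans Q≡ (map-scaleDown (scaleDown-refineˡ d e) QZ))

  common-denominator : ∀ {m} (P N : List (Vec ℚ m)) →
    ∃[ d ] ∃[ PZ ] ∃[ NZ ] (P ≡ List.map (scaleDown d) PZ × N ≡ List.map (scaleDown d) NZ)
  common-denominator P N with list-denominator P | list-denominator N
  ... | e , PZ , P≡ | d , NZ , N≡ =
    e ⊛ d , List.map (Vec.map (ℤ._* + suc d)) PZ , List.map (Vec.map (ℤ._* + suc e)) NZ ,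
    trans P≡ (map-scaleDown (scaleDown-refine e d) PZ) ,
    trans N≡ (map-scaleDown (scaleDown-refineˡ d e) NZ)

  embed≡scaleDown : ∀ {m} (p : Vec Bool m) → embed p ≡ scaleDown 0 (Vec.map b2z p)
  embed≡scaleDown []      = refl
  embed≡scaleDown (b ∷ p) = cong₂ _∷_ (b2q≡scaled b) (embed≡scaleDown p)
    where
    b2q≡scaled : ∀ b → b2q b ≡ fromℤ (b2z b) * 1/suc 0
    b2q≡scaled true  = refl
    b2q≡scaled false = refl

module NearestAnchor {X Y : Set} {m : ℕ} (d : ℕ) (aP : X → Vec ℤ m) (aN : Y → Vec ℤ m)
                     (x₀ : X) (xs : List X) (y₀ : Y) (ys : List Y) where

  open import Data.Integer using (_<_; _≤_)
  open import Data.Integer.Properties using (_<?_; ≤-trans; <-≤-trans; ≤∧≢⇒<; ≮⇒≥; <-cmp)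
  open import Data.Rational as ℚ using (ℚ)
  import Data.Rational.Properties as ℚ using (<-irrefl)
  open import Data.Empty using (⊥)
  open import Relation.Binary using (tri<; tri≈; tri>)
  open import Relation.Nullary using (¬_; Dec; yes; no; does)
  open Minima
  open IntegerDistance
  open RationalScaling

  nearestPositive : Vec Bool m → ℤ
  nearestPositive y = minBy (Δℤ (+ suc d) y ∘ aP) x₀ xs

  nearestNegative : Vec Bool m → ℤ
  nearestNegative y = minBy (Δℤ (+ suc d) y ∘ aN) y₀ ys

  positive-nearer? : ∀ y → Dec (nearestPositive y < nearestNegative y)
  positive-nearer? y = nearestPositive y <? nearestNegative y

  nearer : BF m
  nearer y = does (positive-nearer? y)

  NoTies : Set
  NoTies = ∀ y {u v} → u ∈ x₀ ∷ xs → v ∈ y₀ ∷ ys → Δℤ (+ suc d) y (aP u) ≢ Δℤ (+ suc d) y (aN v)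

  private
    does-true : ∀ {A : Set} (a? : Dec A) → does a? ≡ true → A
    does-true (yes a) _ = a

    does-false : ∀ {A : Set} (a? : Dec A) → does a? ≡ false → ¬ A
    does-false (no ¬a) _ = ¬a

    P N : List (Vec ℚ m)
    P = List.map (scaleDown d ∘ aP) (x₀ ∷ xs)
    N = List.map (scaleDown d ∘ aN) (y₀ ∷ ys)

    closer : ∀ (y : Vec Bool m) a b → Δℤ (+ suc d) y a < Δℤ (+ suc d) y b →
             Δ (embed y) (scaleDown d a) ℚ.< Δ (embed y) (scaleDown d b)
    closer y a b = Δ-scaleDown-mono-< d y a b

  nearer-rep : NoTies → NNRep nearer P N
  nearer-rep no-ties = record { disjoint = disjoint ; pos = pos ; neg = neg }
    where
    disjoint : ∀ p → p ∈ P → p ∈ N → ⊥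
    disjoint p p∈P p∈N with ∈-map⁻ (scaleDown d ∘ aP) p∈P | ∈-map⁻ (scaleDown d ∘ aN) p∈N
    ... | u , u∈ , refl | v , v∈ , same = distinct same
      where
      y = Vec.replicate m false
      distinct : scaleDown d (aP u) ≢ scaleDown d (aN v)
      distinct with <-cmp (Δℤ (+ suc d) y (aP u)) (Δℤ (+ suc d) y (aN v))
      ... | tri< lt _ _ = λ eq → ℚ.<-irrefl (cong (Δ (embed y)) eq) (closer y (aP u) (aN v) lt)
      ... | tri≈ _ eq _ = λ _ → no-ties y u∈ v∈ eq
      ... | tri> _ _ gt = λ eq → ℚ.<-irrefl (cong (Δ (embed y)) (sym eq)) (closer y (aN v) (aP u) gt)

    pos : ∀ y → nearer y ≡ true → ∃[ p ] (p ∈ P × (∀ q → q ∈ N → Δ (embed y) p ℚ.< Δ (embed y) q))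
    pos y nearer≡true with minBy-attained (Δℤ (+ suc d) y ∘ aP) x₀ xs
    ... | u , u∈ , min≡u = scaleDown d (aP u) , ∈-map⁺ (scaleDown d ∘ aP) u∈ , beats
      where
      beats : ∀ q → q ∈ N → Δ (embed y) (scaleDown d (aP u)) ℚ.< Δ (embed y) q
      beats q q∈ with ∈-map⁻ (scaleDown d ∘ aN) q∈
      ... | v , v∈ , refl = closer y (aP u) (aN v) (<-≤-trans
        (subst (_< nearestNegative y) min≡u (does-true (positive-nearer? y) nearer≡true))
        (minBy-≤ (Δℤ (+ suc d) y ∘ aN) ys v∈))

    neg : ∀ y → nearer y ≡ false → ∃[ q ] (q ∈ N × (∀ p → p ∈ P → Δ (embed y) q ℚ.< Δ (embed y) p))
    neg y nearer≡false with minBy-attained (Δℤ (+ suc d) y ∘ aN) y₀ ys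
    ... | v , v∈ , min≡v = scaleDown d (aN v) , ∈-map⁺ (scaleDown d ∘ aN) v∈ , beats
      where
      beats : ∀ p → p ∈ P → Δ (embed y) (scaleDown d (aN v)) ℚ.< Δ (embed y) p
      beats p p∈ with ∈-map⁻ (scaleDown d ∘ aP) p∈
      ... | u , u∈ , refl = closer y (aN v) (aP u) (≤∧≢⇒< v≤u (λ eq → no-ties y u∈ v∈ (sym eq)))
        where
        v≤u : Δℤ (+ suc d) y (aN v) ≤ Δℤ (+ suc d) y (aP u)
        v≤u = ≤-trans (subst (_≤ nearestPositive y) min≡v (≮⇒≥ (does-false (positive-nearer? y) nearer≡false)))
                      (minBy-≤ (Δℤ (+ suc d) y ∘ aP) xs u∈)

module AffineForms where

  open import Data.Integer using (0ℤ; 1ℤ; _+_; _*_; _-_; ∣_∣)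
  import Data.Integer.Properties as ℤ
  open import Data.Integer.Tactic.RingSolver using (solve-∀)
  open import Data.Vec.Relation.Unary.All as All using (All; []; _∷_)
  open IntegerDistance

  infix 7 _·_
  _·_ : ∀ {n} → Vec ℤ n → Vec Bool n → ℤ
  as · x = Vec.foldr _ _+_ 0ℤ (Vec.zipWith (λ a b → a * b2z b) as x)

  zeros : ∀ n → Vec ℤ n
  zeros n = Vec.replicate n 0ℤ

  unit : ∀ {n} → Fin n → ℤ → Vec ℤ n
  unit {suc n} zero    k = k ∷ zeros n
  unit {suc n} (suc i) k = 0ℤ ∷ unit i k

  zeros·x≡0 : ∀ {n} (x : Vec Bool n) → zeros n · x ≡ 0ℤ
  zeros·x≡0 []      = refl
  zeros·x≡0 (b ∷ x) = cong (_+_ (0ℤ * b2z b)) (zeros·x≡0 x)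

  unit·x : ∀ {n} (i : Fin n) k (x : Vec Bool n) → unit i k · x ≡ k * b2z (Vec.lookup x i)
  unit·x zero    k (b ∷ x) = trans (cong (_+_ (k * b2z b)) (zeros·x≡0 x)) (ℤ.+-identityʳ (k * b2z b))
  unit·x (suc i) k (b ∷ x) = trans (ℤ.+-identityˡ (unit i k · x)) (unit·x i k x)

  ·-distrib-+ : ∀ {n} (u v : Vec ℤ n) (x : Vec Bool n) → Vec.zipWith _+_ u v · x ≡ u · x + v · x
  ·-distrib-+ []      []      []      = refl
  ·-distrib-+ (a ∷ u) (c ∷ v) (b ∷ x) =
    trans (cong (_+_ ((a + c) * b2z b)) (·-distrib-+ u v x)) (distrib a c (b2z b) (u · x) (v · x))
    where
    distrib : ∀ a c B s t → (a + c) * B + (s + t) ≡ (a * B + s) + (c * B + t)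
    distrib = solve-∀

  ·-scale : ∀ {n} k (v : Vec ℤ n) (x : Vec Bool n) → Vec.map (k *_) v · x ≡ k * (v · x)
  ·-scale k []      []      = sym (ℤ.*-zeroʳ k)
  ·-scale k (a ∷ v) (b ∷ x) = trans (cong (_+_ (k * a * b2z b)) (·-scale k v x)) (factor k a (b2z b) (v · x))
    where
    factor : ∀ k a B s → k * a * B + k * s ≡ k * (a * B + s)
    factor = solve-∀

  infixl 6 _⊕_
  _⊕_ : ∀ {n} → LinForm n → LinForm n → LinForm n
  (a₀ , as) ⊕ (c₀ , cs) = a₀ + c₀ , Vec.zipWith _+_ as cs

  constForm : ∀ {n} → ℤ → LinForm n
  constForm {n} k = k , zeros n

  shift : ∀ {n} → LinForm n → LinForm n
  shift (a₀ , as) = 1ℤ + a₀ , as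

  evalForm-⊕ : ∀ {n} (F G : LinForm n) x → evalForm (F ⊕ G) x ≡ evalForm F x + evalForm G x
  evalForm-⊕ (a₀ , as) (c₀ , cs) x =
    trans (cong (_+_ (a₀ + c₀)) (·-distrib-+ as cs x)) (regroup a₀ c₀ (as · x) (cs · x))
    where
    regroup : ∀ a c s t → a + c + (s + t) ≡ (a + s) + (c + t)
    regroup = solve-∀

  evalForm-const : ∀ {n} k (x : Vec Bool n) → evalForm (constForm k) x ≡ k
  evalForm-const k x = trans (cong (_+_ k) (zeros·x≡0 x)) (ℤ.+-identityʳ k)

  evalForm-shift : ∀ {n} (F : LinForm n) x → evalForm (shift F) x ≡ 1ℤ + evalForm F x
  evalForm-shift (a₀ , as) x = ℤ.+-assoc 1ℤ a₀ (as · x)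

  sq-affine : ∀ D z b → sq (D * b2z b - z) ≡ sq z + (D * D - + 2 * D * z) * b2z b
  sq-affine D z true  = expand D z
    where
    expand : ∀ D z → (D * 1ℤ - z) * (D * 1ℤ - z) ≡ z * z + (D * D - + 2 * D * z) * 1ℤ
    expand = solve-∀
  sq-affine D z false = expand D z
    where
    expand : ∀ D z → (D * 0ℤ - z) * (D * 0ℤ - z) ≡ z * z + (D * D - + 2 * D * z) * 0ℤ
    expand = solve-∀

  literalForm : ∀ {n} → ℤ → Lit n → ℤ → LinForm n
  literalForm D (var i)   z = sq z , unit i (D * D - + 2 * D * z)
  literalForm D (const b) z = constForm (sq (D * b2z b - z))

  evalForm-literal : ∀ {n} D (l : Lit n) z x → evalForm (literalForm D l z) x ≡ sq (D * b2z (evalLit l x) - z)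
  evalForm-literal D (var i)   z x =
    trans (cong (_+_ (sq z)) (unit·x i _ x)) (sym (sq-affine D z (Vec.lookup x i)))
  evalForm-literal D (const b) z x = evalForm-const _ x

  distanceForm : ∀ {n m} → ℤ → Subst n m → Vec ℤ m → LinForm n
  distanceForm D []      []      = constForm 0ℤ
  distanceForm D (l ∷ σ) (z ∷ a) = literalForm D l z ⊕ distanceForm D σ a

  evalForm-distance : ∀ {n m} D (σ : Subst n m) a x → evalForm (distanceForm D σ a) x ≡ Δℤ D (applySubst σ x) a
  evalForm-distance D []      []      x = evalForm-const 0ℤ x
  evalForm-distance D (l ∷ σ) (z ∷ a) x = trans (evalForm-⊕ (literalForm D l z) (distanceForm D σ a) x)
    (cong₂ _+_ (evalForm-literal D l z x) (evalForm-distance D σ a x))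

  weight-mono : ∀ {n W W′} → W ℕ.≤ W′ → (F : LinForm n) → WeightBound W F → WeightBound W′ F
  weight-mono W≤W′ (a₀ , as) (a₀≤ , as≤) = ℕ.≤-trans a₀≤ W≤W′ , All.map (λ a≤ → ℕ.≤-trans a≤ W≤W′) as≤

  weight-⊕ : ∀ {n W W′} (F G : LinForm n) → WeightBound W F → WeightBound W′ G → WeightBound (W ℕ.+ W′) (F ⊕ G)
  weight-⊕ (a₀ , as) (c₀ , cs) (a₀≤ , as≤) (c₀≤ , cs≤) = bound a₀ c₀ a₀≤ c₀≤ , bounds as≤ cs≤
    where
    bound : ∀ a c {W W′} → ∣ a ∣ ℕ.≤ W → ∣ c ∣ ℕ.≤ W′ → ∣ a + c ∣ ℕ.≤ W ℕ.+ W′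
    bound a c a≤ c≤ = ℕ.≤-trans (ℤ.∣i+j∣≤∣i∣+∣j∣ a c) (ℕ.+-mono-≤ a≤ c≤)
    bounds : ∀ {k W W′} {u v : Vec ℤ k} → All (λ a → ∣ a ∣ ℕ.≤ W) u → All (λ a → ∣ a ∣ ℕ.≤ W′) v →
             All (λ a → ∣ a ∣ ℕ.≤ W ℕ.+ W′) (Vec.zipWith _+_ u v)
    bounds []         []         = []
    bounds {u = a ∷ _} {c ∷ _} (a≤ ∷ u≤) (c≤ ∷ v≤) = bound a c a≤ c≤ ∷ bounds u≤ v≤

  weight-shift : ∀ {n W} (F : LinForm n) → WeightBound W F → WeightBound (suc W) (shift F)
  weight-shift (a₀ , as) (a₀≤ , as≤) =
    ℕ.≤-trans (ℤ.∣i+j∣≤∣i∣+∣j∣ 1ℤ a₀) (ℕ.s≤s a₀≤) , All.map ℕ.m≤n⇒m≤1+n as≤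

  zeros-bounded : ∀ n {W} → All (λ a → ∣ a ∣ ℕ.≤ W) (zeros n)
  zeros-bounded zero    = []
  zeros-bounded (suc n) = ℕ.z≤n ∷ zeros-bounded n

  weight-const : ∀ {n W} k → ∣ k ∣ ℕ.≤ W → WeightBound {n} W (constForm k)
  weight-const {n} k k≤ = k≤ , zeros-bounded n

  weight-literal : ∀ {n} (l : Lit n) b → WeightBound 1 (literalForm (+ 1) l (b2z b))
  weight-literal (var i)       b     = square≤1 b , unit≤ i
    where
    square≤1 : ∀ b → ∣ sq (b2z b) ∣ ℕ.≤ 1
    square≤1 true  = ℕ.≤-refl
    square≤1 false = ℕ.z≤n
    unit≤ : ∀ {n} (i : Fin n) → All (λ a → ∣ a ∣ ℕ.≤ 1) (unit i (+ 1 * + 1 - + 2 * + 1 * b2z b))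
    unit≤ {suc n} zero    = coefficient≤1 b ∷ zeros-bounded n
      where
      coefficient≤1 : ∀ b → ∣ + 1 * + 1 - + 2 * + 1 * b2z b ∣ ℕ.≤ 1
      coefficient≤1 true  = ℕ.≤-refl
      coefficient≤1 false = ℕ.≤-refl
    unit≤ {suc n} (suc i) = ℕ.z≤n ∷ unit≤ i
  weight-literal (const c)     b     = weight-const (sq (+ 1 * b2z c - b2z b)) (square≤1 c b)
    where
    square≤1 : ∀ c b → ∣ sq (+ 1 * b2z c - b2z b) ∣ ℕ.≤ 1
    square≤1 true  true  = ℕ.z≤n
    square≤1 true  false = ℕ.≤-refl
    square≤1 false true  = ℕ.≤-refl
    square≤1 false false = ℕ.z≤n

  weight-distance : ∀ {n m} (σ : Subst n m) (p : Vec Bool m) → WeightBound m (distanceForm (+ 1) σ (Vec.map b2z p))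
  weight-distance []      []      = weight-const 0ℤ ℕ.z≤n
  weight-distance (l ∷ σ) (b ∷ p) =
    weight-⊕ (literalForm (+ 1) l (b2z b)) (distanceForm (+ 1) σ (Vec.map b2z p)) (weight-literal l b) (weight-distance σ p)

module MinPlusFromAnchors where

  open import Data.Integer using (0ℤ; 1ℤ; _+_; _≤_; _<_; +≤+)
  open import Data.Integer.Properties using (≤-refl; _≤?_; <-asym; i<j⇒suc[i]≤j; suc[i]≤j⇒i<j)
  import Data.List.Relation.Unary.All as All
  import Data.List.Relation.Unary.All.Properties as All
  open import Data.Bool using (if_then_else_)
  open import Relation.Nullary using (yes; no; does; contradiction)
  open Minima
  open IntegerDistance
  open RationalScaling
  open AffineForms

  mpPTF-does : ∀ {n} {f : BF n} {L Ls R Rs} → MpPTFRep f L Ls R Rs →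
               ∀ x → f x ≡ does (minForms L Ls x ≤? minForms R Rs x)
  mpPTF-does {f = f} {L} {Ls} {R} {Rs} rep x with f x in fx | minForms L Ls x ≤? minForms R Rs x
  ... | true  | yes _  = refl
  ... | true  | no  ≰  = contradiction (MpPTFRep.sound rep x fx) ≰
  ... | false | yes ≤′ = trans (sym fx) (MpPTFRep.complete rep x ≤′)
  ... | false | no  _  = refl

  mpPTF-cong : ∀ {n} {f g : BF n} {L Ls R Rs} → (∀ x → f x ≡ g x) → MpPTFRep g L Ls R Rs → MpPTFRep f L Ls R Rs
  mpPTF-cong f≗g rep = record
    { sound    = λ x fx → MpPTFRep.sound rep x (trans (sym (f≗g x)) fx)
    ; complete = λ x ≤′ → trans (f≗g x) (MpPTFRep.complete rep x ≤′) }

  constant-mpPTF : ∀ {n} b → MpPTFRep {n} (λ _ → b) (constForm (if b then 0ℤ else 1ℤ)) [] (constForm 0ℤ) []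
  constant-mpPTF true  = record { sound = λ _ _ → ≤-refl ; complete = λ _ _ → refl }
  constant-mpPTF false = record { sound = λ _ () ; complete = λ x 1≤0 → one≰zero x 1≤0 }
    where
    one≰zero : ∀ {n} (x : Vec Bool n) → evalForm (constForm 1ℤ) x ≤ evalForm (constForm 0ℤ) x → false ≡ true
    one≰zero x 1≤0 with subst₂ _≤_ (evalForm-const 1ℤ x) (evalForm-const 0ℤ x) 1≤0
    ... | +≤+ ()

  nn-without-positive : ∀ {m} {g : BF m} {N} → NNRep g [] N → ∀ y → g y ≡ false
  nn-without-positive {g = g} rep y with g y in gy
  ... | false = refl
  ... | true  with () ← NNRep.pos rep y gy

  nn-without-negative : ∀ {m} {g : BF m} {P} → NNRep g P [] → ∀ y → g y ≡ true
  nn-without-negative {g = g} rep y with g y in gy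
  ... | true  = refl
  ... | false with () ← NNRep.neg rep y gy

  module _ {n m : ℕ} (d : ℕ) (σ : Subst n m) where

    positiveForm : Vec ℤ m → LinForm n
    positiveForm a = shift (distanceForm (+ suc d) σ a)

    negativeForm : Vec ℤ m → LinForm n
    negativeForm a = distanceForm (+ suc d) σ a

    evalForm-positive : ∀ a x → evalForm (positiveForm a) x ≡ 1ℤ + Δℤ (+ suc d) (applySubst σ x) a
    evalForm-positive a x = trans (evalForm-shift (distanceForm (+ suc d) σ a) x)
                                  (cong (_+_ 1ℤ) (evalForm-distance (+ suc d) σ a x))

    anchors-mpPTF : ∀ {g : BF m} p ps q qs →
      NNRep g (List.map (scaleDown d) (p ∷ ps)) (List.map (scaleDown d) (q ∷ qs)) →
      MpPTFRep (g ∘ applySubst σ) (positiveForm p) (List.map positiveForm ps) (negativeForm q) (List.map negativeForm qs)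
    anchors-mpPTF {g} p ps q qs rep = record { sound = sound ; complete = complete }
      where
      minP minN : Vec Bool n → ℤ
      minP x = minForms (positiveForm p) (List.map positiveForm ps) x
      minN x = minForms (negativeForm q) (List.map negativeForm qs) x

      sound : ∀ x → g (applySubst σ x) ≡ true → minP x ≤ minN x
      sound x gy with NNRep.pos rep (applySubst σ x) gy
                    | minBy-attained (λ F → evalForm F x) (negativeForm q) (List.map negativeForm qs)
      ... | p′ , p′∈ , p′-wins | G , G∈ , minN≡G
        with ∈-map⁻ (scaleDown d) p′∈ | ∈-map⁻ negativeForm G∈
      ... | u , u∈ , refl | v , v∈ , refl = begin
        minP x                                   ≤⟨ minBy-≤ (λ F → evalForm F x) _ (∈-map⁺ positiveForm u∈) ⟩
        evalForm (positiveForm u) x              ≡⟨ evalForm-positive u x ⟩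
        1ℤ + Δℤ (+ suc d) (applySubst σ x) u     ≤⟨ i<j⇒suc[i]≤j u<v ⟩
        Δℤ (+ suc d) (applySubst σ x) v          ≡⟨ evalForm-distance (+ suc d) σ v x ⟨
        evalForm (negativeForm v) x              ≡⟨ minN≡G ⟨
        minN x                                   ∎
        where
        open Data.Integer.Properties.≤-Reasoning
        u<v = Δ-scaleDown-cancel-< d (applySubst σ x) u v (p′-wins (scaleDown d v) (∈-map⁺ (scaleDown d) v∈))

      complete : ∀ x → minP x ≤ minN x → g (applySubst σ x) ≡ true
      complete x minP≤minN with g (applySubst σ x) in gy
      ... | true  = refl
      ... | false with NNRep.neg rep (applySubst σ x) gy
                     | minBy-attained (λ F → evalForm F x) (positiveForm p) (List.map positiveForm ps)
      ...   | q′ , q′∈ , q′-wins | F , F∈ , minP≡F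
        with ∈-map⁻ (scaleDown d) q′∈ | ∈-map⁻ positiveForm F∈
      ...   | v , v∈ , refl | u , u∈ , refl = contradiction v<u (<-asym u<v)
        where
        y = applySubst σ x
        v<u = Δ-scaleDown-cancel-< d y v u (q′-wins (scaleDown d u) (∈-map⁺ (scaleDown d) u∈))
        u<v : Δℤ (+ suc d) y u < Δℤ (+ suc d) y v
        u<v = suc[i]≤j⇒i<j (begin
          1ℤ + Δℤ (+ suc d) y u          ≡⟨ evalForm-positive u x ⟨
          evalForm (positiveForm u) x    ≡⟨ minP≡F ⟨
          minP x                         ≤⟨ minP≤minN ⟩
          minN x                         ≤⟨ minBy-≤ (λ F → evalForm F x) _ (∈-map⁺ negativeForm v∈) ⟩
          evalForm (negativeForm v) x    ≡⟨ evalForm-distance (+ suc d) σ v x ⟩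
          Δℤ (+ suc d) y v               ∎)
          where open Data.Integer.Properties.≤-Reasoning

    nn⇒mpPTF : ∀ {g : BF m} PZ NZ → NNRep g (List.map (scaleDown d) PZ) (List.map (scaleDown d) NZ) →
      ∃[ L ] ∃[ Ls ] ∃[ R ] ∃[ Rs ] (MpPTFRep (g ∘ applySubst σ) L Ls R Rs
        × terms Ls Rs ℕ.≤ 2 ℕ.+ (length PZ ℕ.+ length NZ)
        × (∀ W → 1 ℕ.≤ W → (∀ {a} → a ∈ PZ → WeightBound W (positiveForm a)) →
             (∀ {a} → a ∈ NZ → WeightBound W (negativeForm a)) → AllWeight W L Ls × AllWeight W R Rs))
    nn⇒mpPTF []       NZ       rep =
      constForm 1ℤ , [] , constForm 0ℤ , [] ,
      mpPTF-cong (nn-without-positive rep ∘ applySubst σ) (constant-mpPTF false) ,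
      ℕ.m≤m+n 2 _ ,
      λ W 1≤W _ _ → (weight-const 1ℤ 1≤W , All.[]) , (weight-const 0ℤ ℕ.z≤n , All.[])
    nn⇒mpPTF (p ∷ ps) []       rep =
      constForm 0ℤ , [] , constForm 0ℤ , [] ,
      mpPTF-cong (nn-without-negative rep ∘ applySubst σ) (constant-mpPTF true) ,
      ℕ.m≤m+n 2 _ ,
      λ W _ _ _ → (weight-const 0ℤ ℕ.z≤n , All.[]) , (weight-const 0ℤ ℕ.z≤n , All.[])
    nn⇒mpPTF (p ∷ ps) (q ∷ qs) rep =
      positiveForm p , List.map positiveForm ps , negativeForm q , List.map negativeForm qs ,
      anchors-mpPTF p ps q qs rep ,
      ℕ.≤-trans (ℕ.≤-reflexive (cong₂ (λ k l → suc k ℕ.+ suc l) (length-map positiveForm ps) (length-map negativeForm qs)))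
                (ℕ.m≤n+m _ 2) ,
      λ W _ boundP boundN → (boundP (here refl) , All.map⁺ (All.tabulate (boundP ∘ there))) ,
                            (boundN (here refl) , All.map⁺ (All.tabulate (boundN ∘ there)))

module PolynomialBounds where

  open import Data.Nat
  open import Data.Nat.Properties
  open import Data.Nat.Tactic.RingSolver using (solve-∀)
  open ≤-Reasoning

  Polynomial : (ℕ → ℕ) → Set
  Polynomial h = ∃[ c ] ∀ n → h n ≤ poly c n

  poly-mono : ∀ c {m n} → m ≤ n → poly c m ≤ poly c n
  poly-mono c m≤n = +-monoˡ-≤ c (*-monoʳ-≤ c (^-monoˡ-≤ c m≤n))

  private
    Bounded : ℕ → ℕ → (ℕ → ℕ) → Set
    Bounded a e h = ∀ n → h n ≤ a * suc n ^ e

    1≤suc^ : ∀ n e → 1 ≤ suc n ^ e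
    1≤suc^ n e = m^n>0 (suc n) e

    *-^ : ∀ x y e → (x * y) ^ e ≡ x ^ e * y ^ e
    *-^ x y zero    = refl
    *-^ x y (suc e) = trans (cong ((x * y) *_) (*-^ x y e)) (interchange x y (x ^ e) (y ^ e))
      where
      interchange : ∀ x y u v → x * y * (u * v) ≡ x * u * (y * v)
      interchange = solve-∀

    poly-bounded : ∀ c → Bounded (c + c) c (poly c)
    poly-bounded c n = begin
      c * n ^ c + c                     ≤⟨ +-mono-≤ (*-monoʳ-≤ c (^-monoˡ-≤ c (n≤1+n n)))
                                                    (m≤m*n c (suc n ^ c) {{>-nonZero (1≤suc^ n c)}}) ⟩
      c * suc n ^ c + c * (suc n ^ c)   ≡⟨ *-distribʳ-+ (suc n ^ c) c c ⟨
      (c + c) * suc n ^ c               ∎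

    bounded⇒polynomial : ∀ a e {h} → Bounded a e h → Polynomial h
    bounded⇒polynomial a e {h} h≤ = c , λ n → ≤-trans (h≤ n) (bound n)
      where
      c = a * 2 ^ e + e
      double : ∀ k → 2 + k + k ≡ 2 * suc k
      double = solve-∀
      bound : ∀ n → a * suc n ^ e ≤ poly c n
      bound zero    = begin
        a * 1 ^ e          ≡⟨ cong (a *_) (^-zeroˡ e) ⟩
        a * 1              ≤⟨ *-monoʳ-≤ a (1≤suc^ 1 e) ⟩
        a * 2 ^ e          ≤⟨ m≤m+n (a * 2 ^ e) e ⟩
        c                  ≤⟨ m≤n+m c (c * 0 ^ c) ⟩
        poly c zero        ∎
      bound (suc k) = begin
        a * (2 + k) ^ e                ≤⟨ *-monoʳ-≤ a (^-monoˡ-≤ e (≤-trans (m≤m+n (2 + k) k) (≤-reflexive (double k)))) ⟩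
        a * (2 * suc k) ^ e            ≡⟨ cong (a *_) (*-^ 2 (suc k) e) ⟩
        a * (2 ^ e * suc k ^ e)        ≤⟨ *-monoʳ-≤ a (*-monoʳ-≤ (2 ^ e) (^-monoʳ-≤ (suc k) (m≤n+m e (a * 2 ^ e)))) ⟩
        a * (2 ^ e * suc k ^ c)        ≡⟨ *-assoc a (2 ^ e) (suc k ^ c) ⟨
        a * 2 ^ e * suc k ^ c          ≤⟨ *-monoˡ-≤ (suc k ^ c) (m≤m+n (a * 2 ^ e) e) ⟩
        c * suc k ^ c                  ≤⟨ m≤m+n (c * suc k ^ c) c ⟩
        poly c (suc k)                 ∎

    polynomial⇒bounded : ∀ {h} → Polynomial h → ∃[ a ] ∃[ e ] Bounded a e h
    polynomial⇒bounded (c , h≤) = c + c , c , λ n → ≤-trans (h≤ n) (poly-bounded c n)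

    raise : ∀ a {e e′} n → e ≤ e′ → a * suc n ^ e ≤ a * suc n ^ e′
    raise a n e≤e′ = *-monoʳ-≤ a (^-monoʳ-≤ (suc n) e≤e′)

  polynomial-poly : ∀ c → Polynomial (poly c)
  polynomial-poly c = c , λ _ → ≤-refl

  polynomial-const : ∀ k → Polynomial (λ _ → k)
  polynomial-const k = bounded⇒polynomial k 0 λ n → ≤-reflexive (sym (*-identityʳ k))

  polynomial-id : Polynomial (λ n → n)
  polynomial-id = bounded⇒polynomial 1 1 λ n → ≤-trans (n≤1+n n) (≤-reflexive (padding n))
    where
    padding : ∀ n → suc n ≡ 1 * (suc n * 1)
    padding = solve-∀

  polynomial-+ : ∀ {g h} → Polynomial g → Polynomial h → Polynomial (λ n → g n + h n)
  polynomial-+ {g} {h} pg ph with polynomial⇒bounded pg | polynomial⇒bounded ph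
  ... | a , e , g≤ | a′ , e′ , h≤ = bounded⇒polynomial (a + a′) (e ⊔ e′) λ n → begin
    g n + h n                                      ≤⟨ +-mono-≤ (g≤ n) (h≤ n) ⟩
    a * suc n ^ e + a′ * suc n ^ e′                ≤⟨ +-mono-≤ (raise a n (m≤m⊔n e e′)) (raise a′ n (m≤n⊔m e e′)) ⟩
    a * suc n ^ (e ⊔ e′) + a′ * suc n ^ (e ⊔ e′)   ≡⟨ *-distribʳ-+ (suc n ^ (e ⊔ e′)) a a′ ⟨
    (a + a′) * suc n ^ (e ⊔ e′)                    ∎

  polynomial-* : ∀ {g h} → Polynomial g → Polynomial h → Polynomial (λ n → g n * h n)
  polynomial-* {g} {h} pg ph with polynomial⇒bounded pg | polynomial⇒bounded ph
  ... | a , e , g≤ | a′ , e′ , h≤ = bounded⇒polynomial (a * a′) (e + e′) λ n → begin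
    g n * h n                              ≤⟨ *-mono-≤ (g≤ n) (h≤ n) ⟩
    a * suc n ^ e * (a′ * suc n ^ e′)      ≡⟨ interchange a a′ (suc n ^ e) (suc n ^ e′) ⟩
    a * a′ * (suc n ^ e * suc n ^ e′)      ≡⟨ cong (a * a′ *_) (^-distribˡ-+-* (suc n) e e′) ⟨
    a * a′ * suc n ^ (e + e′)              ∎
    where
    interchange : ∀ a a′ x y → a * x * (a′ * y) ≡ a * a′ * (x * y)
    interchange = solve-∀

  polynomial-poly∘ : ∀ c {h} → Polynomial h → Polynomial (λ n → poly c (h n))
  polynomial-poly∘ c {h} ph with polynomial⇒bounded ph
  ... | a , e , h≤ = bounded⇒polynomial ((c + c) * suc a ^ c) (e * c) λ n → begin
    poly c (h n)                              ≤⟨ poly-bounded c (h n) ⟩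
    (c + c) * suc (h n) ^ c                   ≤⟨ *-monoʳ-≤ (c + c) (^-monoˡ-≤ c (suc≤ n)) ⟩
    (c + c) * (suc a * suc n ^ e) ^ c         ≡⟨ cong ((c + c) *_) (*-^ (suc a) (suc n ^ e) c) ⟩
    (c + c) * (suc a ^ c * (suc n ^ e) ^ c)   ≡⟨ cong (λ t → (c + c) * (suc a ^ c * t)) (^-*-assoc (suc n) e c) ⟩
    (c + c) * (suc a ^ c * suc n ^ (e * c))   ≡⟨ *-assoc (c + c) (suc a ^ c) (suc n ^ (e * c)) ⟨
    (c + c) * suc a ^ c * suc n ^ (e * c)     ∎
    where
    suc≤ : ∀ n → suc (h n) ≤ suc a * suc n ^ e
    suc≤ n = begin
      suc (h n)                      ≤⟨ s≤s (h≤ n) ⟩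
      suc (a * suc n ^ e)            ≤⟨ +-monoˡ-≤ (a * suc n ^ e) (1≤suc^ n e) ⟩
      suc n ^ e + a * suc n ^ e      ∎

  above : ℕ → ℕ
  above c = proj₁ (polynomial-+ (polynomial-const 1) (polynomial-poly c))

  poly<poly-above : ∀ c m → poly c m < poly (above c) m
  poly<poly-above c = proj₂ (polynomial-+ (polynomial-const 1) (polynomial-poly c))

  composition-bound : ∀ c c′ → ∃[ c″ ] ∀ {n m k} → m ≤ poly c′ n → k ≤ poly c m → 2 + k + m ≤ poly c″ n
  composition-bound c c′ with polynomial-+ (polynomial-+ (polynomial-const 2) (polynomial-poly∘ c (polynomial-poly c′)))
                                          (polynomial-poly c′)
  ... | c″ , bound = c″ , λ {n} m≤ k≤ →
    ≤-trans (+-mono-≤ (+-monoʳ-≤ 2 (≤-trans k≤ (poly-mono c m≤))) m≤) (bound n)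

module FamiliesOnImage where

  open import Data.Nat using (_≤_; _<_; s≤s; _≟_)
  open import Data.Nat.Properties using (anyUpTo?; <-cmp; <-irrefl; ≡-irrelevant)
  open import Relation.Binary using (tri<; tri≈; tri>)
  open import Relation.Nullary using (yes; no; contradiction)
  open PolynomialBounds

  strictlyIncreasing⇒injective : ∀ {M : ℕ → ℕ} → (∀ {a b} → a < b → M a < M b) → ∀ {a b} → M a ≡ M b → a ≡ b
  strictlyIncreasing⇒injective {M} M-< {a} {b} Ma≡Mb with <-cmp a b
  ... | tri< a<b _ _ = contradiction Ma≡Mb (λ eq → <-irrefl eq (M-< a<b))
  ... | tri≈ _ a≡b _ = a≡b
  ... | tri> _ _ b<a = contradiction (sym Ma≡Mb) (λ eq → <-irrefl eq (M-< b<a))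

  module _ {Pack : ℕ → Set} (M : ℕ → ℕ) (M-injective : ∀ {a b} → M a ≡ M b → a ≡ b) (n≤M : ∀ n → n ≤ M n)
           (pack : ∀ n → Pack (M n)) (default : ∀ m → Pack m) where

    fromImage : ∀ m → Pack m
    fromImage m with anyUpTo? (λ k → M k ≟ m) (suc m)
    ... | yes (k , _ , Mk≡m) = subst Pack Mk≡m (pack k)
    ... | no _               = default m

    fromImage-M : ∀ n → fromImage (M n) ≡ pack n
    fromImage-M n with anyUpTo? (λ k → M k ≟ M n) (suc (M n))
    ... | yes (k , _ , Mk≡Mn) = transport Mk≡Mn (M-injective Mk≡Mn)
      where
      transport : ∀ {k} (e : M k ≡ M n) → k ≡ n → subst Pack e (pack k) ≡ pack n
      transport e refl rewrite ≡-irrelevant e refl = refl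
    ... | no none             = contradiction (n , s≤s (n≤M n) , refl) none

  closure-from-image : ∀ (Within : ℕ → (m : ℕ) → BF m → Set) {f : Family} c M →
    (∀ {a b} → M a ≡ M b → a ≡ b) → (∀ n → n ≤ M n) → Polynomial M →
    (∀ m → Σ (BF m) (Within c m)) →
    (∀ n → Σ[ h ∈ BF (M n) ] (Within c (M n) h × SubfunctionVia (f n) h)) →
    closure (λ g → ∃[ c ] ∀ m → Within c m (g m)) f
  closure-from-image Within {f} c M M-injective n≤M (c′ , M≤) default realise =
    g , (c , λ m → proj₂ (fromImage′ m)) , c′ , λ n → M n , M≤ n , subfunction n
    where
    pack : ∀ n → Σ (BF (M n)) (Within c (M n))
    pack n = proj₁ (realise n) , proj₁ (proj₂ (realise n))
    fromImage′ : ∀ m → Σ (BF m) (Within c m)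
    fromImage′ = fromImage M M-injective n≤M pack default
    g : Family
    g m = proj₁ (fromImage′ m)
    subfunction : ∀ n → SubfunctionVia (f n) (g (M n))
    subfunction n with realise n | fromImage-M M M-injective n≤M pack default n
    ... | h , _ , σ , f≡h∘σ | g≡h = σ , λ x → trans (f≡h∘σ x) (cong (λ p → proj₁ p (applySubst σ x)) (sym g≡h))

module Encodings where

  open import Data.Integer using (0ℤ; 1ℤ; _+_; _*_; _≤_; _<_; nonNegative)
  open import Data.Integer.Properties
  open import Data.Integer.Tactic.RingSolver using (solve-∀)
  open import Function.Bundles using (mk⇔)
  open import Relation.Nullary.Decidable using (does-⇔)
  open Minima
  open IntegerDistance
  open RationalScaling
  open MinPlusFromAnchors

  record Encoding {n m} (D K S : ℤ) (σ : Subst n m) (a : Vec ℤ m) (t : Vec Bool n → ℤ) : Set where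
    field
      junk        : ℤ
      0≤junk      : 0ℤ ≤ junk
      junk<scale  : junk < S
      distance    : ∀ x → Δℤ D (applySubst σ x) a ≡ K + S * t x + junk

  encoding-< : ∀ {n m D K S} {σ : Subst n m} {a b t u} → Encoding D K S σ a t → Encoding D K S σ b u →
               ∀ x → t x < u x → Δℤ D (applySubst σ x) a < Δℤ D (applySubst σ x) b
  encoding-< {D = D} {K} {S} {σ} {a} {b} {t} {u} enc-a enc-b x t<u = begin-strict
    Δℤ D (applySubst σ x) a     ≡⟨ A.distance x ⟩
    K + S * t x + A.junk        <⟨ +-monoʳ-< (K + S * t x) A.junk<scale ⟩
    K + S * t x + S             ≡⟨ step K S (t x) ⟩
    K + S * (1ℤ + t x)          ≤⟨ +-monoʳ-≤ K (*-monoˡ-≤-nonNeg S {{nonNegative 0≤S}} (i<j⇒suc[i]≤j t<u)) ⟩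
    K + S * u x                 ≤⟨ i≤i+j (K + S * u x) B.junk {{nonNegative B.0≤junk}} ⟩
    K + S * u x + B.junk        ≡⟨ B.distance x ⟨
    Δℤ D (applySubst σ x) b     ∎
    where
    open ≤-Reasoning
    module A = Encoding enc-a
    module B = Encoding enc-b
    0≤S = <⇒≤ (≤-<-trans A.0≤junk A.junk<scale)
    step : ∀ K S t → K + S * t + S ≡ K + S * (1ℤ + t)
    step = solve-∀

  target : ∀ {n} → Bool → LinForm n → Vec Bool n → ℤ
  target ε F x = + 2 * evalForm F x + b2z ε

  target-≤ : ∀ {n} (F G : LinForm n) x → evalForm F x ≤ evalForm G x → target false F x < target true G x
  target-≤ F G x F≤G = suc[i]≤j⇒i<j (begin
    1ℤ + (+ 2 * evalForm F x + 0ℤ)   ≡⟨ rearrange (evalForm F x) ⟩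
    + 2 * evalForm F x + 1ℤ          ≤⟨ +-monoˡ-≤ 1ℤ (*-monoˡ-≤-nonNeg (+ 2) F≤G) ⟩
    + 2 * evalForm G x + 1ℤ          ∎)
    where
    open ≤-Reasoning
    rearrange : ∀ a → 1ℤ + (+ 2 * a + 0ℤ) ≡ + 2 * a + 1ℤ
    rearrange = solve-∀

  target-> : ∀ {n} (F G : LinForm n) x → evalForm G x < evalForm F x → target true G x < target false F x
  target-> F G x G<F = suc[i]≤j⇒i<j (begin
    1ℤ + (+ 2 * evalForm G x + 1ℤ)   ≡⟨ rearrange (evalForm G x) ⟩
    + 2 * (1ℤ + evalForm G x)        ≤⟨ *-monoˡ-≤-nonNeg (+ 2) (i<j⇒suc[i]≤j G<F) ⟩
    + 2 * evalForm F x               ≡⟨ +-identityʳ _ ⟨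
    + 2 * evalForm F x + 0ℤ          ∎)
    where
    open ≤-Reasoning
    rearrange : ∀ a → 1ℤ + (+ 2 * a + 1ℤ) ≡ + 2 * (1ℤ + a)
    rearrange = solve-∀

  module Realisation {n m} (d : ℕ) (σ : Subst n m) (K S : ℤ) (anchor : Bool → LinForm n → Vec ℤ m)
    {L : LinForm n} {Ls : List (LinForm n)} {R : LinForm n} {Rs : List (LinForm n)}
    (encodes-pos : ∀ {F} → F ∈ L ∷ Ls → Encoding (+ suc d) K S σ (anchor false F) (target false F))
    (encodes-neg : ∀ {G} → G ∈ R ∷ Rs → Encoding (+ suc d) K S σ (anchor true G) (target true G))
    (y₀ : Vec Bool m)
    (opposite-parity : ∀ {F G} → F ∈ L ∷ Ls → G ∈ R ∷ Rs →
       ∃[ j ] (Δℤ (+ suc d) y₀ (anchor true G) ≡ Δℤ (+ suc d) y₀ (anchor false F) + (+ 2 * j + 1ℤ)))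
    where

    open NearestAnchor d (anchor false) (anchor true) L Ls R Rs

    classifier : BF m
    classifier = nearer

    classifier-rep : NNRep classifier (List.map (scaleDown d ∘ anchor false) (L ∷ Ls))
                                      (List.map (scaleDown d ∘ anchor true) (R ∷ Rs))
    classifier-rep = nearer-rep λ y F∈ G∈ → Δℤ-no-tie (+ suc d) y y₀ _ _ (opposite-parity F∈ G∈)

    classifier-realises : ∀ {f} → MpPTFRep f L Ls R Rs → ∀ x → f x ≡ classifier (applySubst σ x)
    classifier-realises rep x = trans (mpPTF-does rep x)
      (does-⇔ (mk⇔ min≤⇒min< min<⇒min≤) (minForms L Ls x ≤? minForms R Rs x) (positive-nearer? (applySubst σ x)))
      where
      evalAt : LinForm n → ℤ
      evalAt F = evalForm F x
      distanceAt : Bool → LinForm n → ℤ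
      distanceAt ε F = Δℤ (+ suc d) (applySubst σ x) (anchor ε F)
      separate-≤ : ∀ {F G} → F ∈ L ∷ Ls → G ∈ R ∷ Rs → evalAt F ≤ evalAt G → distanceAt false F < distanceAt true G
      separate-≤ {F} {G} F∈ G∈ F≤G = encoding-< (encodes-pos F∈) (encodes-neg G∈) x (target-≤ F G x F≤G)
      separate-> : ∀ {F G} → F ∈ L ∷ Ls → G ∈ R ∷ Rs → evalAt G < evalAt F → distanceAt true G < distanceAt false F
      separate-> {F} {G} F∈ G∈ G<F = encoding-< (encodes-neg G∈) (encodes-pos F∈) x (target-> F G x G<F)
      min≤⇒min< = minBy-≤⇒minBy-< evalAt (distanceAt false) evalAt (distanceAt true) separate-≤ separate->
      min<⇒min≤ = minBy-<⇒minBy-≤ evalAt (distanceAt false) evalAt (distanceAt true) separate-≤ separate->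

module Gadgets where

  open import Data.Integer using (0ℤ; 1ℤ; _+_; _*_; _≤_)
  open import Data.Integer.Properties using (≤-refl; +-mono-≤)
  open import Data.Integer.Tactic.RingSolver using (solve-∀)
  open import Data.Vec.Relation.Unary.All using (All; []; _∷_)
  import Data.Vec.Properties as Vec
  open IntegerDistance
  open AffineForms

  block : ∀ {A : Set} B → A → A → Vec A (B ℕ.+ B)
  block B z a = Vec.replicate B a ++ Vec.replicate B z

  spread : ∀ {A : Set} {n} B → A → Vec A n → Vec A (n ℕ.* (B ℕ.+ B))
  spread B z xs = Vec.concat (Vec.map (block B z) xs)

  spreadSubst : ∀ {n k} B → Vec Bool k → Subst n (n ℕ.* (B ℕ.+ B) ℕ.+ k)
  spreadSubst B cs = spread B (const false) (Vec.tabulate var) ++ Vec.map const cs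

  applySubst-spread : ∀ {n k} B (cs : Vec Bool k) (x : Vec Bool n) →
                      applySubst (spreadSubst B cs) x ≡ spread B false x ++ cs
  applySubst-spread B cs x = begin
    Vec.map ev (spread B (const false) (Vec.tabulate var) ++ Vec.map const cs)
      ≡⟨ Vec.map-++ ev (spread B (const false) (Vec.tabulate var)) (Vec.map const cs) ⟩
    Vec.map ev (spread B (const false) (Vec.tabulate var)) ++ Vec.map ev (Vec.map const cs)
      ≡⟨ cong₂ _++_ spread-var (trans (sym (Vec.map-∘ ev const cs)) (Vec.map-id cs)) ⟩
    spread B false x ++ cs ∎
    where
    open ≡-Reasoning
    ev : Lit _ → Bool
    ev l = evalLit l x
    tabulate-var : Vec.map ev (Vec.tabulate var) ≡ x
    tabulate-var = trans (sym (Vec.tabulate-∘ ev var)) (Vec.tabulate∘lookup x)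
    spread-var : Vec.map ev (spread B (const false) (Vec.tabulate var)) ≡ spread B false x
    spread-var = begin
      Vec.map ev (Vec.concat (Vec.map (block B (const false)) (Vec.tabulate var)))
        ≡⟨ Vec.map-concat ev (Vec.map (block B (const false)) (Vec.tabulate var)) ⟩
      Vec.concat (Vec.map (Vec.map ev) (Vec.map (block B (const false)) (Vec.tabulate var)))
        ≡⟨ cong Vec.concat (trans (sym (Vec.map-∘ (Vec.map ev) (block B (const false)) (Vec.tabulate var)))
                                  (trans (Vec.map-cong map-block (Vec.tabulate var))
                                         (Vec.map-∘ (block B false) ev (Vec.tabulate var)))) ⟩
      Vec.concat (Vec.map (block B false) (Vec.map ev (Vec.tabulate var)))
        ≡⟨ cong (Vec.concat ∘ Vec.map (block B false)) tabulate-var ⟩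
      spread B false x ∎
      where
      map-block : ∀ l → Vec.map ev (block B (const false) l) ≡ block B false (ev l)
      map-block l = trans (Vec.map-++ ev (Vec.replicate B l) (Vec.replicate B (const false)))
                          (cong₂ _++_ (Vec.map-replicate ev l B) (Vec.map-replicate ev (const false) B))

  sumsq : ∀ {n} → Vec ℤ n → ℤ
  sumsq = Vec.foldr _ (λ g s → sq g + s) 0ℤ

  sumsq-nonneg : ∀ {n} (v : Vec ℤ n) → 0ℤ ≤ sumsq v
  sumsq-nonneg []      = ≤-refl
  sumsq-nonneg (g ∷ v) = +-mono-≤ (sq-nonneg g) (sumsq-nonneg v)

  module _ {B : ℕ} (D α β δ : ℤ) (Admissible : ℤ → Set) (gadget : ℤ → Vec ℤ (B ℕ.+ B))
    (gadget-law : ∀ {g} → Admissible g → ∀ b → Δℤ D (block B false b) (gadget g) ≡ α + β * (g * b2z b) + δ * sq g)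
    where

    Δℤ-gadgets : ∀ {n} (gs : Vec ℤ n) (x : Vec Bool n) → All Admissible gs →
                 Δℤ D (spread B false x) (Vec.concat (Vec.map gadget gs)) ≡ + n * α + β * (gs · x) + δ * sumsq gs
    Δℤ-gadgets []       []      []         = solve₀ α β δ
      where
      solve₀ : ∀ α β δ → 0ℤ ≡ + 0 * α + β * 0ℤ + δ * 0ℤ
      solve₀ = solve-∀
    Δℤ-gadgets {suc n} (g ∷ gs) (b ∷ x) (ok ∷ oks) = begin
      Δℤ D (block B false b ++ spread B false x) (gadget g ++ Vec.concat (Vec.map gadget gs))
        ≡⟨ Δℤ-++ D (block B false b) (gadget g) (spread B false x) (Vec.concat (Vec.map gadget gs)) ⟩
      Δℤ D (block B false b) (gadget g) + Δℤ D (spread B false x) (Vec.concat (Vec.map gadget gs))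
        ≡⟨ cong₂ _+_ (gadget-law ok b) (Δℤ-gadgets gs x oks) ⟩
      (α + β * (g * b2z b) + δ * sq g) + (+ n * α + β * (gs · x) + δ * sumsq gs)
        ≡⟨ collect α β δ g (b2z b) (+ n) (gs · x) (sumsq gs) ⟩
      (1ℤ + + n) * α + β * (g * b2z b + gs · x) + δ * (sq g + sumsq gs) ∎
      where
      open ≡-Reasoning
      collect : ∀ α β δ g b N s q → (α + β * (g * b) + δ * (g * g)) + (N * α + β * s + δ * q)
                ≡ (1ℤ + N) * α + β * (g * b + s) + δ * (g * g + q)
      collect = solve-∀

module UnboundedWeights where

  open import Data.Integer using (0ℤ; 1ℤ; _+_; _*_; _-_; -_; _≤_; ∣_∣; +≤+; +<+)
  open import Data.Integer.Properties using (0≤i⇒+∣i∣≡i; ≤-<-trans; ≤-reflexive; +-mono-≤; ≤-refl; *-monoˡ-≤-nonNeg)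
  open import Data.Integer.Tactic.RingSolver using (solve-∀)
  open import Data.Vec.Relation.Unary.All using (universal)
  open import Data.Nat.ListAction using (sum)
  open import Data.Unit using (⊤)
  open IntegerDistance
  open AffineForms
  open Gadgets
  open Encodings

  gadget : ℤ → ℤ → Vec ℤ (1 ℕ.+ 1)
  gadget Dz g = + 2 * Dz - + 2 * g ∷ + 2 * Dz + + 2 * g ∷ []

  gadget-law : ∀ Dz g b → Δℤ (+ 4 * Dz) (block 1 false b) (gadget Dz g)
               ≡ + 8 * (Dz * Dz) + + 16 * Dz * (g * b2z b) + + 8 * sq g
  gadget-law Dz g true  = expand Dz g
    where
    expand : ∀ Dz g → (+ 4 * Dz * 1ℤ - (+ 2 * Dz - + 2 * g)) * (+ 4 * Dz * 1ℤ - (+ 2 * Dz - + 2 * g))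
                      + ((+ 4 * Dz * 0ℤ - (+ 2 * Dz + + 2 * g)) * (+ 4 * Dz * 0ℤ - (+ 2 * Dz + + 2 * g)) + 0ℤ)
                      ≡ + 8 * (Dz * Dz) + + 16 * Dz * (g * 1ℤ) + + 8 * (g * g)
    expand = solve-∀
  gadget-law Dz g false = expand Dz g
    where
    expand : ∀ Dz g → (+ 4 * Dz * 0ℤ - (+ 2 * Dz - + 2 * g)) * (+ 4 * Dz * 0ℤ - (+ 2 * Dz - + 2 * g))
                      + ((+ 4 * Dz * 0ℤ - (+ 2 * Dz + + 2 * g)) * (+ 4 * Dz * 0ℤ - (+ 2 * Dz + + 2 * g)) + 0ℤ)
                      ≡ + 8 * (Dz * Dz) + + 16 * Dz * (g * 0ℤ) + + 8 * (g * g)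
    expand = solve-∀

  doubled : ∀ {n} → Vec ℤ n → Vec ℤ n
  doubled = Vec.map (+ 2 *_)

  leading : ∀ {n} → Bool → LinForm n → ℤ
  leading ε F = + 2 * proj₁ F + b2z ε

  anchor : ∀ {n} → ℤ → Bool → LinForm n → Vec ℤ (n ℕ.* (1 ℕ.+ 1) ℕ.+ 2)
  anchor Dz ε F = Vec.concat (Vec.map (gadget Dz) (doubled (proj₂ F))) ++ (- (+ 2 * leading ε F) ∷ b2z ε ∷ [])

  substitution : ∀ {n} → Subst n (n ℕ.* (1 ℕ.+ 1) ℕ.+ 2)
  substitution = spreadSubst 1 (true ∷ false ∷ [])

  offset : ℕ → ℤ → ℤ
  offset n Dz = + n * (+ 8 * (Dz * Dz)) + + 16 * (Dz * Dz)

  junk : ∀ {n} → Bool → LinForm n → ℤ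
  junk ε F = + 4 * sq (leading ε F) + + 8 * sumsq (doubled (proj₂ F)) + b2z ε

  constant-part : ∀ Dz g₀ ε → Δℤ (+ 4 * Dz) (true ∷ false ∷ []) (- (+ 2 * g₀) ∷ b2z ε ∷ [])
                  ≡ + 16 * (Dz * Dz) + + 16 * Dz * g₀ + + 4 * sq g₀ + b2z ε
  constant-part Dz g₀ true  = expand Dz g₀
    where
    expand : ∀ Dz g₀ → (+ 4 * Dz * 1ℤ - - (+ 2 * g₀)) * (+ 4 * Dz * 1ℤ - - (+ 2 * g₀))
                       + ((+ 4 * Dz * 0ℤ - 1ℤ) * (+ 4 * Dz * 0ℤ - 1ℤ) + 0ℤ)
                       ≡ + 16 * (Dz * Dz) + + 16 * Dz * g₀ + + 4 * (g₀ * g₀) + 1ℤ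
    expand = solve-∀
  constant-part Dz g₀ false = expand Dz g₀
    where
    expand : ∀ Dz g₀ → (+ 4 * Dz * 1ℤ - - (+ 2 * g₀)) * (+ 4 * Dz * 1ℤ - - (+ 2 * g₀))
                       + ((+ 4 * Dz * 0ℤ - 0ℤ) * (+ 4 * Dz * 0ℤ - 0ℤ) + 0ℤ)
                       ≡ + 16 * (Dz * Dz) + + 16 * Dz * g₀ + + 4 * (g₀ * g₀) + 0ℤ
    expand = solve-∀

  distance : ∀ {n} Dz ε (F : LinForm n) x → Δℤ (+ 4 * Dz) (applySubst substitution x) (anchor Dz ε F)
             ≡ offset n Dz + + 16 * Dz * target ε F x + junk ε F
  distance {n} Dz ε F@(f₀ , fs) x = begin
    Δℤ (+ 4 * Dz) (applySubst substitution x) (anchor Dz ε F)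
      ≡⟨ cong (λ y → Δℤ (+ 4 * Dz) y (anchor Dz ε F)) (applySubst-spread 1 (true ∷ false ∷ []) x) ⟩
    Δℤ (+ 4 * Dz) (spread 1 false x ++ (true ∷ false ∷ [])) (anchor Dz ε F)
      ≡⟨ Δℤ-++ (+ 4 * Dz) (spread 1 false x) (Vec.concat (Vec.map (gadget Dz) (doubled fs)))
               (true ∷ false ∷ []) (- (+ 2 * g₀) ∷ b2z ε ∷ []) ⟩
    Δℤ (+ 4 * Dz) (spread 1 false x) (Vec.concat (Vec.map (gadget Dz) (doubled fs)))
      + Δℤ (+ 4 * Dz) (true ∷ false ∷ []) (- (+ 2 * g₀) ∷ b2z ε ∷ [])
      ≡⟨ cong₂ _+_ (Δℤ-gadgets {1} (+ 4 * Dz) α β (+ 8) (λ _ → ⊤) (gadget Dz) (λ {g} _ → gadget-law Dz g)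
                               (doubled fs) x (universal _ (doubled fs)))
                   (constant-part Dz g₀ ε) ⟩
    (+ n * α + β * (doubled fs · x) + + 8 * sumsq (doubled fs)) + (+ 16 * (Dz * Dz) + β * g₀ + + 4 * sq g₀ + b2z ε)
      ≡⟨ cong (λ s → (+ n * α + β * s + + 8 * sumsq (doubled fs)) + (+ 16 * (Dz * Dz) + β * g₀ + + 4 * sq g₀ + b2z ε))
              (·-scale (+ 2) fs x) ⟩
    (+ n * α + β * (+ 2 * (fs · x)) + + 8 * sumsq (doubled fs)) + (+ 16 * (Dz * Dz) + β * g₀ + + 4 * sq g₀ + b2z ε)
      ≡⟨ collect (+ n) Dz f₀ (fs · x) (sumsq (doubled fs)) (b2z ε) ⟩
    offset n Dz + + 16 * Dz * target ε F x + junk ε F ∎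
    where
    open ≡-Reasoning
    α = + 8 * (Dz * Dz)
    β = + 16 * Dz
    g₀ = leading ε F
    collect : ∀ N Dz f₀ s q E →
      (N * (+ 8 * (Dz * Dz)) + + 16 * Dz * (+ 2 * s) + + 8 * q)
        + (+ 16 * (Dz * Dz) + + 16 * Dz * (+ 2 * f₀ + E) + + 4 * ((+ 2 * f₀ + E) * (+ 2 * f₀ + E)) + E)
      ≡ (N * (+ 8 * (Dz * Dz)) + + 16 * (Dz * Dz)) + + 16 * Dz * (+ 2 * (f₀ + s) + E)
        + (+ 4 * ((+ 2 * f₀ + E) * (+ 2 * f₀ + E)) + + 8 * q + E)
    collect = solve-∀

  junk-nonneg : ∀ {n} ε (F : LinForm n) → 0ℤ ≤ junk ε F
  junk-nonneg ε F = +-mono-≤ (+-mono-≤ (*-monoˡ-≤-nonNeg (+ 4) (sq-nonneg (leading ε F)))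
                                        (*-monoˡ-≤-nonNeg (+ 8) (sumsq-nonneg (doubled (proj₂ F)))))
                             (b2z-nonneg ε)
    where
    b2z-nonneg : ∀ ε → 0ℤ ≤ b2z ε
    b2z-nonneg true  = +≤+ ℕ.z≤n
    b2z-nonneg false = ≤-refl

  ∈⇒≤sum : ∀ {k ks} → k ∈ ks → k ℕ.≤ sum ks
  ∈⇒≤sum {ks = k ∷ ks} (here refl) = ℕ.m≤m+n k (sum ks)
  ∈⇒≤sum {ks = k ∷ ks} (there k∈)  = ℕ.≤-trans (∈⇒≤sum k∈) (ℕ.m≤n+m (sum ks) k)

  module Construction {n} (L : LinForm n) (Ls : List (LinForm n)) (R : LinForm n) (Rs : List (LinForm n)) where

    junkBound-pos junkBound-neg junkBound : ℕ
    junkBound-pos = sum (List.map (∣_∣ ∘ junk false) (L ∷ Ls))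
    junkBound-neg = sum (List.map (∣_∣ ∘ junk true) (R ∷ Rs))
    junkBound     = junkBound-pos ℕ.+ junkBound-neg

    Dz : ℤ
    Dz = + suc junkBound

    -- + suc d reduces to + 4 * Dz.
    d : ℕ
    d = junkBound ℕ.+ 3 ℕ.* suc junkBound

    encodes : ∀ ε F → ∣ junk ε F ∣ ℕ.≤ junkBound →
              Encoding (+ suc d) (offset n Dz) (+ 16 * Dz) substitution (anchor Dz ε F) (target ε F)
    encodes ε F small = record
      { junk       = junk ε F
      ; 0≤junk     = junk-nonneg ε F
      ; junk<scale = ≤-<-trans (≤-reflexive (sym (0≤i⇒+∣i∣≡i (junk-nonneg ε F))))
                               (+<+ (ℕ.≤-trans (ℕ.s≤s small) (ℕ.m≤n*m (suc junkBound) 16)))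
      ; distance   = distance {n} Dz ε F }

    junk-small : ∀ ε {F Fs} → F ∈ Fs → ∣ junk {n} ε F ∣ ℕ.≤ sum (List.map (∣_∣ ∘ junk ε) Fs)
    junk-small ε F∈ = ∈⇒≤sum (∈-map⁺ (∣_∣ ∘ junk ε) F∈)

    encodes-pos : ∀ {F} → F ∈ L ∷ Ls →
                  Encoding (+ suc d) (offset n Dz) (+ 16 * Dz) substitution (anchor Dz false F) (target false F)
    encodes-pos {F} F∈ = encodes false F (ℕ.≤-trans (junk-small false F∈) (ℕ.m≤m+n junkBound-pos junkBound-neg))

    encodes-neg : ∀ {G} → G ∈ R ∷ Rs →
                  Encoding (+ suc d) (offset n Dz) (+ 16 * Dz) substitution (anchor Dz true G) (target true G)
    encodes-neg {G} G∈ = encodes true G (ℕ.≤-trans (junk-small true G∈) (ℕ.m≤n+m junkBound-neg junkBound-pos))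

    reference : Vec Bool (n ℕ.* (1 ℕ.+ 1) ℕ.+ 2)
    reference = applySubst substitution (Vec.replicate n false)

    opposite-parity : ∀ {F G} → F ∈ L ∷ Ls → G ∈ R ∷ Rs →
      ∃[ j ] (Δℤ (+ suc d) reference (anchor Dz true G) ≡ Δℤ (+ suc d) reference (anchor Dz false F) + (+ 2 * j + 1ℤ))
    opposite-parity {F} {G} _ _ = j , (begin
      Δℤ (+ suc d) reference (anchor Dz true G)
        ≡⟨ distance {n} Dz true G x₀ ⟩
      offset n Dz + + 16 * Dz * target true G x₀ + junk true G
        ≡⟨ shuffle (offset n Dz) Dz a b p q r s ⟩
      offset n Dz + + 16 * Dz * target false F x₀ + junk false F + (+ 2 * j + 1ℤ)
        ≡⟨ cong (_+ (+ 2 * j + 1ℤ)) (distance {n} Dz false F x₀) ⟨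
      Δℤ (+ suc d) reference (anchor Dz false F) + (+ 2 * j + 1ℤ) ∎)
      where
      open ≡-Reasoning
      x₀ = Vec.replicate n false
      a = evalForm G x₀
      b = evalForm F x₀
      p = sq (leading true G)
      q = sumsq (doubled (proj₂ G))
      r = sq (leading false F)
      s = sumsq (doubled (proj₂ F))
      j = + 8 * Dz * (+ 2 * (a - b) + 1ℤ) + + 2 * (p - r) + + 4 * (q - s)
      shuffle : ∀ K Dz a b p q r s →
        K + + 16 * Dz * (+ 2 * a + 1ℤ) + (+ 4 * p + + 8 * q + 1ℤ)
        ≡ K + + 16 * Dz * (+ 2 * b + 0ℤ) + (+ 4 * r + + 8 * s + 0ℤ)
          + (+ 2 * (+ 8 * Dz * (+ 2 * (a - b) + 1ℤ) + + 2 * (p - r) + + 4 * (q - s)) + 1ℤ)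
      shuffle = solve-∀

    open Realisation d substitution (offset n Dz) (+ 16 * Dz) (anchor Dz) encodes-pos encodes-neg reference opposite-parity public

module BoundedWeights where

  open import Data.Integer using (-[1+_]; 0ℤ; 1ℤ; _+_; _*_; _-_; -_; _≤_; ∣_∣; +≤+; -≤-; -≤+; +<+)
  open import Data.Integer.Properties
    using (≤-refl; i≤j⇒0≤j-i; +-identityˡ; +-monoʳ-≤; neg-mono-≤; m-n≡m⊖n; ⊖-≥; neg-≤-pos; module ≤-Reasoning)
  open import Data.Integer.Tactic.RingSolver using (solve-∀)
  import Data.List.Relation.Unary.All as All
  import Data.Vec.Properties as Vec
  open IntegerDistance
  open AffineForms
  open Gadgets
  open Encodings

  -- t ones, then zeros; truncated when t > k.
  ones : ℕ → (k : ℕ) → Vec Bool k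
  ones zero    k       = Vec.replicate k false
  ones (suc t) zero    = []
  ones (suc t) (suc k) = true ∷ ones t k

  Δℤ-zeros : ∀ k → Δℤ (+ 1) (Vec.replicate k false) (Vec.map b2z (Vec.replicate k false)) ≡ 0ℤ
  Δℤ-zeros zero    = refl
  Δℤ-zeros (suc k) = trans (+-identityˡ _) (Δℤ-zeros k)

  Δℤ-ones-false : ∀ {t k} → t ℕ.≤ k → Δℤ (+ 1) (Vec.replicate k false) (Vec.map b2z (ones t k)) ≡ + t
  Δℤ-ones-false {zero}  {k}     _           = Δℤ-zeros k
  Δℤ-ones-false {suc t} {suc k} (ℕ.s≤s t≤k) = cong (_+_ 1ℤ) (Δℤ-ones-false t≤k)

  Δℤ-ones-true : ∀ {t k} → t ℕ.≤ k → Δℤ (+ 1) (Vec.replicate k true) (Vec.map b2z (ones t k)) ≡ + (k ℕ.∸ t)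
  Δℤ-ones-true {zero}  {zero}  _           = refl
  Δℤ-ones-true {zero}  {suc k} _           = cong (_+_ 1ℤ) (Δℤ-ones-true {zero} {k} ℕ.z≤n)
  Δℤ-ones-true {suc t} {suc k} (ℕ.s≤s t≤k) = trans (+-identityˡ _) (Δℤ-ones-true t≤k)

  count-of : ∀ {z k} → 0ℤ ≤ z → z ≤ + k → ∣ z ∣ ℕ.≤ k × + ∣ z ∣ ≡ z
  count-of (+≤+ _) (+≤+ m≤k) = m≤k , refl

  abs-bounds : ∀ {f W} → ∣ f ∣ ℕ.≤ W → - + W ≤ f × f ≤ + W
  abs-bounds {+ _}                 f≤W         = neg-≤-pos , +≤+ f≤W
  abs-bounds { -[1+ _ ]} {suc _} (ℕ.s≤s f≤W) = -≤- f≤W , -≤+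

  bit : Bool → ℕ
  bit true  = 1
  bit false = 0

  b2z≡+bit : ∀ ε → b2z ε ≡ + bit ε
  b2z≡+bit true  = refl
  b2z≡+bit false = refl

  module _ (W : ℕ) where

    low high : ℤ → ℕ
    low  f = ∣ + W - f ∣
    high f = ∣ + W + f ∣

    low-count : ∀ f → ∣ f ∣ ℕ.≤ W → low f ℕ.≤ W ℕ.+ W × + low f ≡ + W - f
    low-count f f≤W with abs-bounds {f} f≤W
    ... | -W≤f , f≤+W = count-of (i≤j⇒0≤j-i f≤+W) (begin
      + W - f       ≤⟨ +-monoʳ-≤ (+ W) (neg-mono-≤ -W≤f) ⟩
      + W - - + W   ≡⟨ cancel (+ W) ⟩
      + W + + W     ∎)
      where
      open ≤-Reasoning
      cancel : ∀ w → w - - w ≡ w + w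
      cancel = solve-∀

    high-count : ∀ f → ∣ f ∣ ℕ.≤ W → high f ℕ.≤ W ℕ.+ W × + high f ≡ + W + f
    high-count f f≤W with abs-bounds {f} f≤W
    ... | -W≤f , f≤+W = count-of (begin
      0ℤ            ≡⟨ cancel (+ W) ⟩
      + W + - + W   ≤⟨ +-monoʳ-≤ (+ W) -W≤f ⟩
      + W + f       ∎) (+-monoʳ-≤ (+ W) f≤+W)
      where
      open ≤-Reasoning
      cancel : ∀ w → 0ℤ ≡ w + - w
      cancel = solve-∀

    gadget : ℤ → Vec Bool ((W ℕ.+ W) ℕ.+ (W ℕ.+ W))
    gadget f = ones (low f) (W ℕ.+ W) ++ ones (high f) (W ℕ.+ W)

    gadget-law : ∀ {f} → ∣ f ∣ ℕ.≤ W → ∀ b →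
      Δℤ (+ 1) (block (W ℕ.+ W) false b) (Vec.map b2z (gadget f)) ≡ + 2 * + W + + 2 * (f * b2z b) + 0ℤ * sq f
    gadget-law {f} f≤W b with low-count f f≤W | high-count f f≤W
    ... | low≤ , low≡ | high≤ , high≡ = begin
      Δℤ (+ 1) (Vec.replicate (W ℕ.+ W) b ++ Vec.replicate (W ℕ.+ W) false)
               (Vec.map b2z (ones (low f) (W ℕ.+ W) ++ ones (high f) (W ℕ.+ W)))
        ≡⟨ cong (Δℤ (+ 1) (Vec.replicate (W ℕ.+ W) b ++ Vec.replicate (W ℕ.+ W) false))
                (Vec.map-++ b2z (ones (low f) (W ℕ.+ W)) (ones (high f) (W ℕ.+ W))) ⟩
      Δℤ (+ 1) (Vec.replicate (W ℕ.+ W) b ++ Vec.replicate (W ℕ.+ W) false)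
               (Vec.map b2z (ones (low f) (W ℕ.+ W)) ++ Vec.map b2z (ones (high f) (W ℕ.+ W)))
        ≡⟨ Δℤ-++ (+ 1) (Vec.replicate (W ℕ.+ W) b) (Vec.map b2z (ones (low f) (W ℕ.+ W)))
                 (Vec.replicate (W ℕ.+ W) false) (Vec.map b2z (ones (high f) (W ℕ.+ W))) ⟩
      Δℤ (+ 1) (Vec.replicate (W ℕ.+ W) b) (Vec.map b2z (ones (low f) (W ℕ.+ W)))
        + Δℤ (+ 1) (Vec.replicate (W ℕ.+ W) false) (Vec.map b2z (ones (high f) (W ℕ.+ W)))
        ≡⟨ cong₂ _+_ (first-half b) (trans (Δℤ-ones-false high≤) high≡) ⟩
      (+ W - f) + + 2 * f * b2z b + (+ W + f)
        ≡⟨ collect (+ W) f (b2z b) ⟩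
      + 2 * + W + + 2 * (f * b2z b) + 0ℤ * sq f ∎
      where
      open ≡-Reasoning
      collect : ∀ w f b → (w - f) + + 2 * f * b + (w + f) ≡ + 2 * w + + 2 * (f * b) + 0ℤ * (f * f)
      collect = solve-∀
      first-half : ∀ b → Δℤ (+ 1) (Vec.replicate (W ℕ.+ W) b) (Vec.map b2z (ones (low f) (W ℕ.+ W)))
                         ≡ (+ W - f) + + 2 * f * b2z b
      first-half false = trans (Δℤ-ones-false low≤) (trans low≡ (pad (+ W) f))
        where
        pad : ∀ w f → w - f ≡ (w - f) + + 2 * f * 0ℤ
        pad = solve-∀
      first-half true  = begin
        Δℤ (+ 1) (Vec.replicate (W ℕ.+ W) true) (Vec.map b2z (ones (low f) (W ℕ.+ W)))
          ≡⟨ Δℤ-ones-true low≤ ⟩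
        + (W ℕ.+ W ℕ.∸ low f)
          ≡⟨ trans (m-n≡m⊖n (W ℕ.+ W) (low f)) (⊖-≥ low≤) ⟨
        + W + + W - + low f
          ≡⟨ cong (λ t → + W + + W - t) low≡ ⟩
        + W + + W - (+ W - f)
          ≡⟨ rearrange (+ W) f ⟩
        (+ W - f) + + 2 * f * 1ℤ ∎
        where
        rearrange : ∀ w f → w + w - (w - f) ≡ (w - f) + + 2 * f * 1ℤ
        rearrange = solve-∀

    tail : ℕ → ℕ
    tail n = (W ℕ.+ W) ℕ.+ (W ℕ.+ W) ℕ.+ suc n

    size : ℕ → ℕ
    size n = n ℕ.* ((W ℕ.+ W) ℕ.+ (W ℕ.+ W)) ℕ.+ tail n

    leading : ∀ {n} → Bool → LinForm n → ℕ
    leading ε F = high (proj₁ F) ℕ.+ high (proj₁ F) ℕ.+ bit ε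

    anchor : ∀ {n} → Bool → LinForm n → Vec Bool (size n)
    anchor {n} ε F = Vec.concat (Vec.map gadget (proj₂ F)) ++ ones (leading ε F) (tail n)

    substitution : ∀ {n} → Subst n (size n)
    substitution {n} = spreadSubst (W ℕ.+ W) (Vec.replicate (tail n) false)

    offset : ℕ → ℤ
    offset n = + n * (+ 2 * + W) + + 2 * + W

    distance : ∀ {n} ε (F : LinForm n) → WeightBound W F → ∀ x →
               Δℤ (+ 1) (applySubst substitution x) (Vec.map b2z (anchor ε F)) ≡ offset n + 1ℤ * target ε F x + 0ℤ
    distance {n} ε F@(f₀ , fs) (f₀≤W , fs≤W) x with high-count f₀ f₀≤W
    ... | high≤ , high≡ = begin
      Δℤ (+ 1) (applySubst substitution x) (Vec.map b2z (anchor ε F))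
        ≡⟨ cong₂ (Δℤ (+ 1)) (applySubst-spread (W ℕ.+ W) (Vec.replicate (tail n) false) x) map-anchor ⟩
      Δℤ (+ 1) (spread (W ℕ.+ W) false x ++ Vec.replicate (tail n) false)
               (Vec.concat (Vec.map (Vec.map b2z ∘ gadget) fs) ++ Vec.map b2z (ones (leading ε F) (tail n)))
        ≡⟨ Δℤ-++ (+ 1) (spread (W ℕ.+ W) false x) (Vec.concat (Vec.map (Vec.map b2z ∘ gadget) fs))
                 (Vec.replicate (tail n) false) (Vec.map b2z (ones (leading ε F) (tail n))) ⟩
      Δℤ (+ 1) (spread (W ℕ.+ W) false x) (Vec.concat (Vec.map (Vec.map b2z ∘ gadget) fs))
        + Δℤ (+ 1) (Vec.replicate (tail n) false) (Vec.map b2z (ones (leading ε F) (tail n)))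
        ≡⟨ cong₂ _+_ (Δℤ-gadgets {W ℕ.+ W} (+ 1) (+ 2 * + W) (+ 2) 0ℤ (λ f → ∣ f ∣ ℕ.≤ W) (Vec.map b2z ∘ gadget)
                                 (λ {g} → gadget-law {g}) fs x fs≤W)
                     (Δℤ-ones-false leading≤) ⟩
      + n * (+ 2 * + W) + + 2 * (fs · x) + 0ℤ * sumsq fs + + leading ε F
        ≡⟨ cong (λ t → + n * (+ 2 * + W) + + 2 * (fs · x) + 0ℤ * sumsq fs + (t + t + + bit ε)) high≡ ⟩
      + n * (+ 2 * + W) + + 2 * (fs · x) + 0ℤ * sumsq fs + ((+ W + f₀) + (+ W + f₀) + + bit ε)
        ≡⟨ cong (λ e → + n * (+ 2 * + W) + + 2 * (fs · x) + 0ℤ * sumsq fs + ((+ W + f₀) + (+ W + f₀) + e))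
                (sym (b2z≡+bit ε)) ⟩
      + n * (+ 2 * + W) + + 2 * (fs · x) + 0ℤ * sumsq fs + ((+ W + f₀) + (+ W + f₀) + b2z ε)
        ≡⟨ collect (+ n) (+ W) f₀ (fs · x) (sumsq fs) (b2z ε) ⟩
      offset n + 1ℤ * target ε F x + 0ℤ ∎
      where
      open ≡-Reasoning
      leading≤ : leading ε F ℕ.≤ tail n
      leading≤ = ℕ.+-mono-≤ (ℕ.+-mono-≤ high≤ high≤) (bit≤ ε)
        where
        bit≤ : ∀ ε → bit ε ℕ.≤ suc n
        bit≤ true  = ℕ.s≤s ℕ.z≤n
        bit≤ false = ℕ.z≤n
      map-anchor : Vec.map b2z (anchor ε F)
                   ≡ Vec.concat (Vec.map (Vec.map b2z ∘ gadget) fs) ++ Vec.map b2z (ones (leading ε F) (tail n))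
      map-anchor = trans (Vec.map-++ b2z (Vec.concat (Vec.map gadget fs)) (ones (leading ε F) (tail n)))
                         (cong (_++ Vec.map b2z (ones (leading ε F) (tail n)))
                               (trans (Vec.map-concat b2z (Vec.map gadget fs))
                                      (cong Vec.concat (sym (Vec.map-∘ (Vec.map b2z) gadget fs)))))
      collect : ∀ N w f₀ s q e →
        N * (+ 2 * w) + + 2 * s + 0ℤ * q + ((w + f₀) + (w + f₀) + e)
        ≡ N * (+ 2 * w) + + 2 * w + 1ℤ * (+ 2 * (f₀ + s) + e) + 0ℤ
      collect = solve-∀

    anchorℤ : ∀ {n} → Bool → LinForm n → Vec ℤ (size n)
    anchorℤ ε F = Vec.map b2z (anchor ε F)

    weight-∈ : ∀ {n} {F L : LinForm n} {Ls} → AllWeight W L Ls → F ∈ L ∷ Ls → WeightBound W F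
    weight-∈ (L≤ , _)   (here refl) = L≤
    weight-∈ (_ , Ls≤) (there F∈)  = All.lookup Ls≤ F∈

    module Construction {n} {L : LinForm n} {Ls} {R : LinForm n} {Rs}
                        (weights-pos : AllWeight W L Ls) (weights-neg : AllWeight W R Rs) where

      encodes : ∀ ε F → WeightBound W F → Encoding (+ 1) (offset n) 1ℤ substitution (anchorℤ ε F) (target ε F)
      encodes ε F F≤W = record
        { junk       = 0ℤ
        ; 0≤junk     = ≤-refl
        ; junk<scale = +<+ (ℕ.s≤s ℕ.z≤n)
        ; distance   = distance {n} ε F F≤W }

      encodes-pos : ∀ {F} → F ∈ L ∷ Ls → Encoding (+ 1) (offset n) 1ℤ substitution (anchorℤ false F) (target false F)
      encodes-pos {F} F∈ = encodes false F (weight-∈ {n} weights-pos F∈)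

      encodes-neg : ∀ {G} → G ∈ R ∷ Rs → Encoding (+ 1) (offset n) 1ℤ substitution (anchorℤ true G) (target true G)
      encodes-neg {G} G∈ = encodes true G (weight-∈ {n} weights-neg G∈)

      reference : Vec Bool (size n)
      reference = applySubst substitution (Vec.replicate n false)

      opposite-parity : ∀ {F G} → F ∈ L ∷ Ls → G ∈ R ∷ Rs →
               ∃[ j ] (Δℤ (+ 1) reference (anchorℤ true G) ≡ Δℤ (+ 1) reference (anchorℤ false F) + (+ 2 * j + 1ℤ))
      opposite-parity {F} {G} F∈ G∈ = evalForm G x₀ - evalForm F x₀ , (begin
        Δℤ (+ 1) reference (anchorℤ true G)
          ≡⟨ Encoding.distance (encodes-neg G∈) x₀ ⟩
        offset n + 1ℤ * target true G x₀ + 0ℤ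
          ≡⟨ shuffle (offset n) (evalForm G x₀) (evalForm F x₀) ⟩
        offset n + 1ℤ * target false F x₀ + 0ℤ + (+ 2 * (evalForm G x₀ - evalForm F x₀) + 1ℤ)
          ≡⟨ cong (_+ (+ 2 * (evalForm G x₀ - evalForm F x₀) + 1ℤ)) (Encoding.distance (encodes-pos F∈) x₀) ⟨
        Δℤ (+ 1) reference (anchorℤ false F) + (+ 2 * (evalForm G x₀ - evalForm F x₀) + 1ℤ) ∎)
        where
        open ≡-Reasoning
        x₀ = Vec.replicate n false
        shuffle : ∀ K a b → K + 1ℤ * (+ 2 * a + 1ℤ) + 0ℤ ≡ K + 1ℤ * (+ 2 * b + 0ℤ) + 0ℤ + (+ 2 * (a - b) + 1ℤ)
        shuffle = solve-∀

      open Realisation 0 substitution (offset n) 1ℤ anchorℤ encodes-pos encodes-neg reference opposite-parity public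

open PolynomialBounds
open FamiliesOnImage
open RationalScaling
open AffineForms
open MinPlusFromAnchors

NNWithin : ℕ → (m : ℕ) → BF m → Set
NNWithin c m g = ∃[ P ] ∃[ N ] (NNRep g P N × length P ℕ.+ length N ℕ.≤ poly c m)

HNNWithin : ℕ → (m : ℕ) → BF m → Set
HNNWithin c m g = ∃[ P ] ∃[ N ] (NNRep g (List.map embed P) (List.map embed N) × length P ℕ.+ length N ℕ.≤ poly c m)

length-map₂ : ∀ {A B C : Set} (h : A → B) (h′ : A → C) xs ys →
              length (List.map h xs) ℕ.+ length (List.map h′ ys) ≡ length xs ℕ.+ length ys
length-map₂ h h′ xs ys = cong₂ ℕ._+_ (length-map h xs) (length-map h′ ys)

closureNN⇒mpPTF∞ : ∀ f → closure NN f → mpPTF∞ f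
closureNN⇒mpPTF∞ f (g , (c , g-NN) , c′ , f-sub) with composition-bound c c′
... | c″ , bound = c″ , forms
  where
  forms : ∀ n → ∃[ L ] ∃[ Ls ] ∃[ R ] ∃[ Rs ] (MpPTFRep (f n) L Ls R Rs × terms Ls Rs ℕ.≤ poly c″ n)
  forms n with f-sub n
  ... | m , m≤ , σ , f≡g∘σ with g-NN m
  ...   | P , N , rep , size≤ with common-denominator P N
  ...     | d , PZ , NZ , refl , refl with nn⇒mpPTF d σ PZ NZ rep
  ...       | L , Ls , R , Rs , rep′ , terms≤ , _ =
    L , Ls , R , Rs , mpPTF-cong f≡g∘σ rep′ ,
    ℕ.≤-trans terms≤ (ℕ.≤-trans (ℕ.m≤m+n _ m) (bound m≤ (subst (ℕ._≤ poly c m) (length-map₂ _ _ PZ NZ) size≤)))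

map-embed : ∀ {m} (P : List (Vec Bool m)) → List.map embed P ≡ List.map (scaleDown 0) (List.map (Vec.map b2z) P)
map-embed P = trans (map-cong embed≡scaleDown P) (map-∘ P)

closureHNN⇒mpPTFpoly : ∀ f → closure HNN f → mpPTFpoly f
closureHNN⇒mpPTFpoly f (g , (c , g-HNN) , c′ , f-sub) with composition-bound c c′
... | c″ , bound = c″ , forms
  where
  forms : ∀ n → ∃[ L ] ∃[ Ls ] ∃[ R ] ∃[ Rs ] (MpPTFRep (f n) L Ls R Rs × terms Ls Rs ℕ.≤ poly c″ n
            × AllWeight (poly c″ n) L Ls × AllWeight (poly c″ n) R Rs)
  forms n with f-sub n
  ... | m , m≤ , σ , f≡g∘σ with g-HNN m
  ...   | P , N , rep , size≤
    with nn⇒mpPTF 0 σ (List.map (Vec.map b2z) P) (List.map (Vec.map b2z) N) (subst₂ (NNRep (g m)) (map-embed P) (map-embed N) rep)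
  ...   | L , Ls , R , Rs , rep′ , terms≤ , weights =
    L , Ls , R , Rs , mpPTF-cong f≡g∘σ rep′ ,
    ℕ.≤-trans terms≤ (ℕ.≤-trans (ℕ.m≤m+n _ m) total≤) ,
    weights (poly c″ n) (ℕ.≤-trans (ℕ.s≤s ℕ.z≤n) suc-m≤)
            (λ {a} a∈ → weight-mono suc-m≤ (positiveForm 0 σ a) (positive-weight a∈))
            (λ {a} a∈ → weight-mono (ℕ.≤-trans (ℕ.n≤1+n m) suc-m≤) (negativeForm 0 σ a) (negative-weight a∈))
    where
    k = length (List.map (Vec.map b2z) P) ℕ.+ length (List.map (Vec.map b2z) N)
    total≤ : 2 ℕ.+ k ℕ.+ m ℕ.≤ poly c″ n
    total≤ = bound m≤ (subst (ℕ._≤ poly c m) (sym (length-map₂ _ _ P N)) size≤)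
    suc-m≤ : suc m ℕ.≤ poly c″ n
    suc-m≤ = ℕ.≤-trans (ℕ.s≤s (ℕ.m≤n+m m (suc k))) total≤
    positive-weight : ∀ {a} → a ∈ List.map (Vec.map b2z) P → WeightBound (suc m) (positiveForm 0 σ a)
    positive-weight a∈ with ∈-map⁻ (Vec.map b2z) a∈
    ... | p , _ , refl = weight-shift (distanceForm (+ 1) σ (Vec.map b2z p)) (weight-distance σ p)
    negative-weight : ∀ {a} → a ∈ List.map (Vec.map b2z) N → WeightBound m (negativeForm 0 σ a)
    negative-weight a∈ with ∈-map⁻ (Vec.map b2z) a∈
    ... | p , _ , refl = weight-distance σ p

false-rep : ∀ m → NNRep {m} (λ _ → false) [] (List.map embed (Vec.replicate m false ∷ []))
false-rep m = record
  { disjoint = λ _ ()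
  ; pos      = λ _ ()
  ; neg      = λ _ _ → embed (Vec.replicate m false) , here refl , λ _ () }

anchors≤ : ∀ c {n m} {A B : Set} (h : LinForm n → A) (h′ : LinForm n → B) L Ls R Rs → n ℕ.≤ m →
           terms Ls Rs ℕ.≤ poly c n →
           length (List.map h (L ∷ Ls)) ℕ.+ length (List.map h′ (R ∷ Rs)) ℕ.≤ poly (above c) m
anchors≤ c {m = m} h h′ L Ls R Rs n≤m terms≤ = begin
  length (List.map h (L ∷ Ls)) ℕ.+ length (List.map h′ (R ∷ Rs))   ≡⟨ length-map₂ h h′ (L ∷ Ls) (R ∷ Rs) ⟩
  terms Ls Rs                                                       ≤⟨ terms≤ ⟩
  poly c _                                                          ≤⟨ poly-mono c n≤m ⟩
  poly c m                                                          <⟨ poly<poly-above c m ⟩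
  poly (above c) m                                                  ∎
  where open ℕ.≤-Reasoning

mpPTF∞⇒closureNN : ∀ f → mpPTF∞ f → closure NN f
mpPTF∞⇒closureNN f (c , f-mpPTF) =
  closure-from-image NNWithin (above c) M M-injective n≤M M-polynomial default realise
  where
  M : ℕ → ℕ
  M n = n ℕ.* (1 ℕ.+ 1) ℕ.+ 2
  M-injective : ∀ {a b} → M a ≡ M b → a ≡ b
  M-injective = strictlyIncreasing⇒injective (λ a<b → ℕ.+-monoˡ-< 2 (ℕ.*-monoˡ-< 2 a<b))
  n≤M : ∀ n → n ℕ.≤ M n
  n≤M n = ℕ.≤-trans (ℕ.m≤m*n n 2) (ℕ.m≤m+n (n ℕ.* 2) 2)
  M-polynomial : Polynomial M
  M-polynomial = polynomial-+ (polynomial-* polynomial-id (polynomial-const 2)) (polynomial-const 2)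
  default : ∀ m → Σ (BF m) (NNWithin (above c) m)
  default m = (λ _ → false) , [] , _ , false-rep m , ℕ.≤-trans (ℕ.s≤s ℕ.z≤n) (poly<poly-above c m)
  realise : ∀ n → Σ[ h ∈ BF (M n) ] (NNWithin (above c) (M n) h × SubfunctionVia (f n) h)
  realise n with f-mpPTF n
  ... | L , Ls , R , Rs , rep , terms≤ =
    classifier ,
    (_ , _ , classifier-rep ,
     anchors≤ c (scaleDown d ∘ anchor Dz false) (scaleDown d ∘ anchor Dz true) L Ls R Rs (n≤M n) terms≤) ,
    substitution , classifier-realises rep
    where
    open UnboundedWeights
    open UnboundedWeights.Construction L Ls R Rs

map-embed∘ : ∀ {n m} (a : LinForm n → Vec Bool m) (Fs : List (LinForm n)) →
             List.map (scaleDown 0 ∘ Vec.map b2z ∘ a) Fs ≡ List.map embed (List.map a Fs)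
map-embed∘ a Fs = trans (sym (map-cong (embed≡scaleDown ∘ a) Fs)) (map-∘ Fs)

mpPTFpoly⇒closureHNN : ∀ f → mpPTFpoly f → closure HNN f
mpPTFpoly⇒closureHNN f (c , f-mpPTF) =
  closure-from-image HNNWithin (above c) M M-injective n≤M M-polynomial default realise
  where
  M : ℕ → ℕ
  M n = BoundedWeights.size (poly c n) n
  M-increasing : ∀ {a b} → a ℕ.< b → M a ℕ.< M b
  M-increasing {a} {b} a<b = ℕ.+-mono-≤-< (ℕ.*-mono-≤ (ℕ.<⇒≤ a<b) X≤) (ℕ.+-mono-≤-< X≤ (ℕ.s≤s a<b))
    where
    W≤ = poly-mono c (ℕ.<⇒≤ a<b)
    X≤ = ℕ.+-mono-≤ (ℕ.+-mono-≤ W≤ W≤) (ℕ.+-mono-≤ W≤ W≤)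
  M-injective : ∀ {a b} → M a ≡ M b → a ≡ b
  M-injective = strictlyIncreasing⇒injective M-increasing
  n≤M : ∀ n → n ℕ.≤ M n
  n≤M n = ℕ.≤-trans (ℕ.n≤1+n n) (ℕ.≤-trans (ℕ.m≤n+m (suc n) X) (ℕ.m≤n+m (X ℕ.+ suc n) (n ℕ.* X)))
    where X = (poly c n ℕ.+ poly c n) ℕ.+ (poly c n ℕ.+ poly c n)
  M-polynomial : Polynomial M
  M-polynomial = polynomial-+ (polynomial-* polynomial-id X) (polynomial-+ X (polynomial-+ (polynomial-const 1) polynomial-id))
    where
    W+W = polynomial-+ (polynomial-poly c) (polynomial-poly c)
    X = polynomial-+ W+W W+W
  default : ∀ m → Σ (BF m) (HNNWithin (above c) m)
  default m = (λ _ → false) , [] , _ , false-rep m , ℕ.≤-trans (ℕ.s≤s ℕ.z≤n) (poly<poly-above c m)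
  realise : ∀ n → Σ[ h ∈ BF (M n) ] (HNNWithin (above c) (M n) h × SubfunctionVia (f n) h)
  realise n with f-mpPTF n
  ... | L , Ls , R , Rs , rep , terms≤ , weights-pos , weights-neg =
    classifier ,
    (_ , _ , subst₂ (NNRep classifier) (map-embed∘ (anchor W false) (L ∷ Ls)) (map-embed∘ (anchor W true) (R ∷ Rs))
                    classifier-rep ,
     anchors≤ c (anchor W false) (anchor W true) L Ls R Rs (n≤M n) terms≤) ,
    substitution W , classifier-realises rep
    where
    W = poly c n
    open BoundedWeights
    open BoundedWeights.Construction W {n} {L} {Ls} {R} {Rs} weights-pos weights-neg

theorem1 : (closure NN ≐ mpPTF∞) × (closure HNN ≐ mpPTFpoly)
theorem1 = (λ f → closureNN⇒mpPTF∞ f , mpPTF∞⇒closureNN f)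
         , (λ f → closureHNN⇒mpPTFpoly f , mpPTFpoly⇒closureHNN f)
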